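{- Let $\tau$ be a partition and let $S,S'$ be two sequences over the alphabet $[k]$ such that $M(S,k)$ is stack-equivalent to $M(S',k)$. Then the partition pattern $\sigma=12\cdots k\,S(\tau+k)$ is equivalent to $\sigma'=12\cdots k\,S'(\tau+k)$.
   Context: $\tau+k$ adds $k$ to every term; juxtaposition is concatenation. Rows are numbered bottom to top, columns left to right. A stack polyomino is a finite set of grid cells arranged in contiguous rows and columns such that every column meeting row $i$ also meets all rows with smaller index. A semi-standard filling assigns 0/1 to the cells with exactly one 1 per column. A filling $F$ contains an $r\times c$ 0-1 matrix $M$ if there are rows $i_1<\dots<i_r$ and columns $j_1<\dots<j_c$ with all cells $(i_a,j_b)$ in the diagram and cell $(i_a,j_b)$ equal to 1 whenever $M$ has a 1 in row $a$, column $b$; otherwise it avoids $M$. $M,M'$ are stack-equivalent if every stack polyomino has equally many semi-standard fillings avoiding $M$ as avoiding $M'$. $M(S,k)$, for a sequence $S=s_1\cdots s_m$ over $[k]$, is the $k\times m$ 0-1 matrix with a 1 in row $i$, column $j$ iff $s_j=i$. Partitions of $[n]$ are identified with canonical sequences ($\pi_i=j$ iff $i$ is in the $j$-th block, blocks ordered by increasing minima); a partition contains a pattern if it has a subsequence order-isomorphic to it; patterns $\sigma,\sigma'$ are equivalent if for all $n$ equally many partitions of $[n]$ avoid $\sigma$ as avoid $\sigma'$. -}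

module Defs where

open import Data.Nat using (ℕ; zero; suc; _+_; _≤_; _<_; _⊔_; _⊓_; _≡ᵇ_)
open import Data.Bool using (Bool; true; false)
open import Data.Fin as Fin using (Fin; toℕ; fromℕ<)
open import Data.List as List using (List; []; _∷_; length; _++_; upTo; map)
open import Data.List.Relation.Unary.All using (All; []; _∷_)
open import Data.Vec as Vec using (Vec; toList)
open import Data.Product using (Σ; ∃; _×_; _,_)
open import Data.Irrelevant using (Irrelevant)
open import Data.Unit using (⊤)
open import Relation.Nullary using (¬_)
open import Relation.Binary.PropositionalEquality using (_≡_)
open import Function.Bundles using (_↔_)
open import Data.Nat.Properties using (_<?_)
open import Relation.Nullary.Decidable using (yes; no)

-- 0-1 matrices with r rows and c columns.  Row index a : Fin r, column
-- index b : Fin c; rows are numbered bottom to top (index 0 = bottom row).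

Matrix : ℕ → ℕ → Set
Matrix r c = Fin r → Fin c → Bool

StrictlyIncreasingFinℕ : {r : ℕ} → (Fin r → ℕ) → Set
StrictlyIncreasingFinℕ {r} f = (a b : Fin r) → a Fin.< b → f a < f b

StrictlyIncreasingFin : {c m : ℕ} → (Fin c → Fin m) → Set
StrictlyIncreasingFin {c} f = (a b : Fin c) → a Fin.< b → f a Fin.< f b

-- A diagram whose columns are bottom-justified (each column meeting row i
-- meets all lower rows) is given by its list of column heights
-- hs = h_1 ... h_m (left to right); the cells of column j are the rows
-- 0 .. h_j - 1 (0-based, bottom to top).  Columns are contiguous (every
-- listed column is nonempty) and rows are contiguous (the columns meeting
-- any given row form an interval, i.e. for j1 < j2 < j3 we have
-- min(h_j1, h_j3) ≤ h_j2).

IsStackPolyomino : List ℕ → Set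
IsStackPolyomino hs =
  All (λ h → 1 ≤ h) hs ×
  ((j₁ j₂ j₃ : Fin (length hs)) → j₁ Fin.< j₂ → j₂ Fin.< j₃ →
     (List.lookup hs j₁ ⊓ List.lookup hs j₃) ≤ List.lookup hs j₂)

-- A 0/1 filling of the diagram with column heights hs: one Vec Bool h_j per
-- column (entry i of column j is the value of cell (row i, column j)).
Filling : List ℕ → Set
Filling hs = All (Vec Bool) hs

ones : {h : ℕ} → Vec Bool h → ℕ
ones Vec.[] = 0
ones (true Vec.∷ v) = suc (ones v)
ones (false Vec.∷ v) = ones v

SemiStandard : {hs : List ℕ} → Filling hs → Set
SemiStandard [] = ⊤
SemiStandard (v ∷ F) = (ones v ≡ 1) × SemiStandard F

entry : {hs : List ℕ} → Filling hs → Fin (length hs) → ℕ → Bool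
entry {h ∷ hs} (v ∷ F) Fin.zero i with i <? h
... | yes p = Vec.lookup v (fromℕ< p)
... | no _ = false
entry {h ∷ hs} (v ∷ F) (Fin.suc j) i = entry F j i

Contains : {r c : ℕ} → Matrix r c → {hs : List ℕ} → Filling hs → Set
Contains {r} {c} M {hs} F =
  Σ (Fin r → ℕ) λ rows → Σ (Fin c → Fin (length hs)) λ cols →
    StrictlyIncreasingFinℕ rows × StrictlyIncreasingFin cols ×
    ((a : Fin r) (b : Fin c) → rows a < List.lookup hs (cols b)) ×
    ((a : Fin r) (b : Fin c) → M a b ≡ true → entry F (cols b) (rows a) ≡ true)

Avoids : {r c : ℕ} → Matrix r c → {hs : List ℕ} → Filling hs → Set
Avoids M F = ¬ Contains M F

-- The (finite) set of semi-standard fillings of hs avoiding M.  The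
-- property is wrapped in Irrelevant so that elements are determined by
-- the filling alone.
AvoidingFillings : {r c : ℕ} → Matrix r c → List ℕ → Set
AvoidingFillings M hs = Σ (Filling hs) λ F → Irrelevant (SemiStandard F × Avoids M F)

-- stack-equivalence: for every stack polyomino, equally many (i.e. in
-- bijection; these sets are finite) semi-standard fillings avoid M as M'.
StackEquivalent : {r c r' c' : ℕ} → Matrix r c → Matrix r' c' → Set
StackEquivalent M M' =
  (hs : List ℕ) → IsStackPolyomino hs → AvoidingFillings M hs ↔ AvoidingFillings M' hs

-- M(S,k): the k × |S| matrix with a 1 in row i, column j iff s_j = i
-- (rows 1..k represented by Fin k, row i ↔ index i-1).

M[_,_] : (S : List ℕ) (k : ℕ) → Matrix k (length S)
M[ S , k ] i j = List.lookup S j ≡ᵇ suc (toℕ i)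

OverAlphabet : ℕ → List ℕ → Set
OverAlphabet k S = All (λ s → 1 ≤ s × s ≤ k) S

-- Set partitions as canonical sequences (restricted growth sequences):
-- π_1 = 1 and 1 ≤ π_i ≤ 1 + max(π_1,...,π_{i-1}).

RestrictedGrowth : ℕ → List ℕ → Set
RestrictedGrowth m [] = ⊤
RestrictedGrowth m (x ∷ xs) = 1 ≤ x × x ≤ suc m × RestrictedGrowth (m ⊔ x) xs

IsPartition : List ℕ → Set
IsPartition π = RestrictedGrowth 0 π

ContainsPattern : List ℕ → List ℕ → Set
ContainsPattern σ π =
  Σ (Fin (length σ) → Fin (length π)) λ ι →
    StrictlyIncreasingFin ι ×
    ((a b : Fin (length σ)) →
       (List.lookup σ a < List.lookup σ b → List.lookup π (ι a) < List.lookup π (ι b)) ×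
       (List.lookup π (ι a) < List.lookup π (ι b) → List.lookup σ a < List.lookup σ b))

AvoidsPattern : List ℕ → List ℕ → Set
AvoidsPattern σ π = ¬ ContainsPattern σ π

AvoidingPartitions : List ℕ → ℕ → Set
AvoidingPartitions σ n =
  Σ (Vec ℕ n) λ π → Irrelevant (IsPartition (toList π) × AvoidsPattern σ (toList π))

PatternEquivalent : List ℕ → List ℕ → Set
PatternEquivalent σ σ' = (n : ℕ) → AvoidingPartitions σ n ↔ AvoidingPartitions σ' n

_+ₛ_ : List ℕ → ℕ → List ℕ
τ +ₛ k = map (_+ k) τ

ascending : ℕ → List ℕ
ascending k = map suc (upTo k)

-- A partition is handled as a restricted growth function x. Give each position q the
-- height h q: the largest i, not exceeding the maximum of x before q, such that τ occurs to
-- the right of q using only values above i. The positions q with 1 ≤ x q ≤ h q, with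
-- these heights, form a stack polyomino (the heights along a row form an interval), and
-- x q becomes the 1 in row x q of its column. An occurrence of 12⋯k S (τ+k) in x is then
-- the same as an occurrence of M(S,k) in this semi-standard filling: 12⋯k can be taken
-- at first occurrences, and τ+k at the occurrence of τ witnessing the height of the last
-- column used. Conversely, rereading the values at the column positions from any
-- semi-standard filling of the same shape changes neither prefix maxima nor heights (by
-- induction from the right, rerouting occurrences of τ around the columns), so it gives
-- a partition with the same polyomino. Thus the bijections between M(S,k)- and
-- M(S',k)-avoiding fillings of each stack polyomino transport to partitions.

module Submission where

open import Defs
open import Data.Bool using (Bool; true; false)
open import Data.Bool.Properties using (T-≡)
import Data.Bool.Properties as Boolₚ
open import Data.Empty using (⊥; ⊥-elim)
open import Data.Fin as Fin using (Fin; zero; suc; toℕ; fromℕ<; _↑ˡ_; _↑ʳ_; splitAt)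
import Data.Fin.Properties as Finₚ
open import Data.Irrelevant as Irrelevant using (Irrelevant; [_])
open import Data.List as List using (List; []; _∷_; length; _++_; map; upTo; applyUpTo)
import Data.List.Properties as Listₚ
open import Data.List.Membership.Propositional.Properties using (∈-lookup)
open import Data.List.Relation.Unary.All as All using (All; []; _∷_)
open import Data.Nat
open import Data.Nat.Properties
open import Data.Product using (Σ; ∃; _×_; _,_; proj₁; proj₂)
open import Data.Sum using (_⊎_; inj₁; inj₂; [_,_]′)
open import Data.Unit using (tt)
open import Data.Vec as Vec using (Vec; []; _∷_; toList; tabulate)
import Data.Vec.Functional as Functional
import Data.Vec.Properties as Vecₚ
open import Function using (_∘_; id)
open import Function.Bundles using (_⇔_; mk⇔; Equivalence; Inverse; _↔_; mk↔ₛ′)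
open import Function.Properties.Inverse using (↔-refl; ↔-sym)
open import Relation.Nullary using (Dec; ¬_; contradiction)
open import Relation.Nullary.Decidable using (yes; no; does; map′; dec-true; _×-dec_; _→-dec_; recompute)
open import Relation.Binary.PropositionalEquality

SameOrder : ℕ → ℕ → ℕ → ℕ → Set
SameOrder u v u′ v′ = (u < v → u′ < v′) × (u′ < v′ → u < v)

sameOrder-resp : ∀ {u v u′ v′ u₀ v₀ u₀′ v₀′} → u ≡ u₀ → v ≡ v₀ → u′ ≡ u₀′ → v′ ≡ v₀′ →
  SameOrder u₀ v₀ u₀′ v₀′ → SameOrder u v u′ v′
sameOrder-resp refl refl refl refl same = same

OrderIsomorphic : ∀ {s N} → (Fin s → ℕ) → (Fin N → ℕ) → (Fin s → Fin N) → Set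
OrderIsomorphic f g ι = ∀ a b → SameOrder (f a) (f b) (g (ι a)) (g (ι b))

-- ContainsPattern σ π unfolds to Embeds (List.lookup σ) (List.lookup π).
Embeds : ∀ {s N} → (Fin s → ℕ) → (Fin N → ℕ) → Set
Embeds f g = Σ _ λ ι → StrictlyIncreasingFin ι × OrderIsomorphic f g ι

-- also applies to StrictlyIncreasingFin ι, with f = toℕ ∘ ι
strictlyIncreasing-mono : ∀ {s} {f : Fin s → ℕ} → StrictlyIncreasingFinℕ f → ∀ a b → toℕ a ≤ toℕ b → f a ≤ f b
strictlyIncreasing-mono {f = f} inc a b a≤b with m≤n⇒m<n∨m≡n a≤b
... | inj₁ a<b = <⇒≤ (inc a b a<b)
... | inj₂ a≡b = ≤-reflexive (cong f (Finₚ.toℕ-injective a≡b))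

strictlyIncreasing-reflects : ∀ {s} {f : Fin s → ℕ} → StrictlyIncreasingFinℕ f → ∀ {a b} → f a < f b → a Fin.< b
strictlyIncreasing-reflects inc {a} {b} fa<fb = ≰⇒> λ b≤a → <⇒≱ fa<fb (strictlyIncreasing-mono inc b a b≤a)

orderIsomorphic-congˡ : ∀ {s N} {f f′ : Fin s → ℕ} {g : Fin N → ℕ} {ι} →
  f ≗ f′ → OrderIsomorphic f g ι → OrderIsomorphic f′ g ι
orderIsomorphic-congˡ f≗ iso a b =
  (λ lt → proj₁ (iso a b) (subst₂ _<_ (sym (f≗ a)) (sym (f≗ b)) lt)) ,
  (λ lt → subst₂ _<_ (f≗ a) (f≗ b) (proj₂ (iso a b) lt))

orderIsomorphic-congʳ : ∀ {s N} {f : Fin s → ℕ} {g g′ : Fin N → ℕ} {ι} →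
  g ∘ ι ≗ g′ ∘ ι → OrderIsomorphic f g ι → OrderIsomorphic f g′ ι
orderIsomorphic-congʳ g≗ iso a b =
  (λ lt → subst₂ _<_ (g≗ a) (g≗ b) (proj₁ (iso a b) lt)) ,
  (λ lt → proj₂ (iso a b) (subst₂ _<_ (sym (g≗ a)) (sym (g≗ b)) lt))

embeds-congˡ : ∀ {s N} {f f′ : Fin s → ℕ} {g : Fin N → ℕ} → f ≗ f′ → Embeds f g → Embeds f′ g
embeds-congˡ {g = g} f≗ (ι , inc , iso) = ι , inc , orderIsomorphic-congˡ {g = g} f≗ iso

embeds-congʳ : ∀ {s N} {f : Fin s → ℕ} {g g′ : Fin N → ℕ} → g ≗ g′ → Embeds f g → Embeds f g′
embeds-congʳ {g = g} {g′} g≗ (ι , inc , iso) = ι , inc , orderIsomorphic-congʳ {g = g} {g′} {ι} (g≗ ∘ ι) iso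

embeds-reindexˡ : ∀ {s s′ N} {f : Fin s → ℕ} {f′ : Fin s′ → ℕ} {g : Fin N → ℕ} (e : s ≡ s′) →
  (∀ i → f i ≡ f′ (Fin.cast e i)) → Embeds f g ⇔ Embeds f′ g
embeds-reindexˡ {f = f} {f′} {g} refl f≡f′∘cast =
  mk⇔ (embeds-congˡ {g = g} f≗f′) (embeds-congˡ {g = g} (sym ∘ f≗f′))
  where
  f≗f′ : f ≗ f′
  f≗f′ i = trans (f≡f′∘cast i) (cong f′ (Finₚ.cast-is-id refl i))

embeds-reindexʳ : ∀ {s N N′} {f : Fin s → ℕ} {g : Fin N → ℕ} {g′ : Fin N′ → ℕ} (e : N ≡ N′) →
  (∀ j → g j ≡ g′ (Fin.cast e j)) → Embeds f g ⇔ Embeds f g′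
embeds-reindexʳ {f = f} {g} {g′} refl g≡g′∘cast =
  mk⇔ (embeds-congʳ {f = f} g≗g′) (embeds-congʳ {f = f} (sym ∘ g≗g′))
  where
  g≗g′ : g ≗ g′
  g≗g′ j = trans (g≡g′∘cast j) (cong g′ (Finₚ.cast-is-id refl j))

anyFunction? : ∀ {t N} (P : (Fin t → Fin N) → Set) → (∀ {f g} → f ≗ g → P f → P g) →
  (∀ f → Dec (P f)) → Dec (∃ P)
anyFunction? {zero} P respects P? = map′ (_ ,_) (λ (f , p) → respects (λ ()) p) (P? λ ())
anyFunction? {suc t} P respects P? =
  map′ (λ (x , g , p) → x Functional.∷ g , p)
       (λ (f , p) → f zero , f ∘ suc , respects (λ { zero → refl ; (suc i) → refl }) p)
       (Finₚ.any? λ x → anyFunction? (P ∘ (x Functional.∷_))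
          (λ f≗g → respects λ { zero → refl ; (suc i) → f≗g i }) (P? ∘ (x Functional.∷_)))

strictlyIncreasing? : ∀ {t N} (ι : Fin t → Fin N) → Dec (StrictlyIncreasingFin ι)
strictlyIncreasing? ι = Finₚ.all? λ a → Finₚ.all? λ b → a Finₚ.<? b →-dec ι a Finₚ.<? ι b

orderIsomorphic? : ∀ {s N} (f : Fin s → ℕ) (g : Fin N → ℕ) ι → Dec (OrderIsomorphic f g ι)
orderIsomorphic? f g ι = Finₚ.all? λ a → Finₚ.all? λ b →
  (f a <? f b →-dec g (ι a) <? g (ι b)) ×-dec (g (ι a) <? g (ι b) →-dec f a <? f b)

strictlyIncreasing-resp : ∀ {t N} {f g : Fin t → Fin N} → f ≗ g → StrictlyIncreasingFin f → StrictlyIncreasingFin g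
strictlyIncreasing-resp f≗g inc a b a<b = subst₂ Fin._<_ (f≗g a) (f≗g b) (inc a b a<b)

orderIsomorphic-resp : ∀ {s N} {f : Fin s → ℕ} {g : Fin N → ℕ} {ι ι′} → ι ≗ ι′ →
  OrderIsomorphic f g ι → OrderIsomorphic f g ι′
orderIsomorphic-resp {g = g} ι≗ι′ iso a b =
  (λ lt → subst₂ _<_ (cong g (ι≗ι′ a)) (cong g (ι≗ι′ b)) (proj₁ (iso a b) lt)) ,
  (λ lt → proj₂ (iso a b) (subst₂ _<_ (cong g (sym (ι≗ι′ a))) (cong g (sym (ι≗ι′ b))) lt))

orderIsomorphic-≡ : ∀ {s N} {f : Fin s → ℕ} {g : Fin N → ℕ} {ι} → OrderIsomorphic f g ι →
  ∀ {a b} → f a ≡ f b → g (ι a) ≡ g (ι b)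
orderIsomorphic-≡ iso {a} {b} fa≡fb = ≤-antisym
  (≮⇒≥ λ gb<ga → <-irrefl (sym fa≡fb) (proj₂ (iso b a) gb<ga))
  (≮⇒≥ λ ga<gb → <-irrefl fa≡fb (proj₂ (iso a b) ga<gb))

valueAt : ∀ {N} → (Fin N → ℕ) → ℕ → ℕ
valueAt {N} x j with j <? N
... | yes j<N = x (fromℕ< j<N)
... | no _ = 0

valueAt-fromℕ< : ∀ {N} (x : Fin N → ℕ) {j} (j<N : j < N) → valueAt x j ≡ x (fromℕ< j<N)
valueAt-fromℕ< {N} x {j} j<N with j <? N
... | yes j<N′ = cong x (Finₚ.fromℕ<-cong j j refl j<N′ j<N)
... | no j≮N = contradiction j<N j≮N

valueAt-outside : ∀ {N} (x : Fin N → ℕ) {j} → ¬ j < N → valueAt x j ≡ 0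
valueAt-outside {N} x {j} j≮N with j <? N
... | yes j<N = contradiction j<N j≮N
... | no _ = refl

valueAt-toℕ : ∀ {N} (x : Fin N → ℕ) q → valueAt x (toℕ q) ≡ x q
valueAt-toℕ x q = trans (valueAt-fromℕ< x (Finₚ.toℕ<n q)) (cong x (Finₚ.fromℕ<-toℕ q (Finₚ.toℕ<n q)))

prefixMax : ∀ {N} → (Fin N → ℕ) → ℕ → ℕ
prefixMax x zero = 0
prefixMax x (suc j) = prefixMax x j ⊔ valueAt x j

prefixMax-mono : ∀ {N} (x : Fin N → ℕ) {j j′} → j ≤ j′ → prefixMax x j ≤ prefixMax x j′
prefixMax-mono x {j′ = zero} z≤n = ≤-refl
prefixMax-mono x {zero} {suc j′} _ = z≤n
prefixMax-mono x {suc j} {suc j′} j≤j′ with m≤n⇒m<n∨m≡n j≤j′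
... | inj₁ (s≤s j<j′) = ≤-trans (prefixMax-mono x j<j′) (m≤m⊔n _ _)
... | inj₂ refl = ≤-refl

≤-prefixMax : ∀ {N} (x : Fin N → ℕ) q {j} → toℕ q < j → x q ≤ prefixMax x j
≤-prefixMax x q {suc j} (s≤s q≤j) = begin
  x q                                ≡⟨ valueAt-toℕ x q ⟨
  valueAt x (toℕ q)                  ≤⟨ m≤n⊔m (prefixMax x (toℕ q)) _ ⟩
  prefixMax x (suc (toℕ q))          ≤⟨ prefixMax-mono x (s≤s q≤j) ⟩
  prefixMax x (suc j)                ∎
  where open ≤-Reasoning

valueAt-cong : ∀ {N} {x x′ : Fin N → ℕ} → x ≗ x′ → ∀ j → valueAt x j ≡ valueAt x′ j
valueAt-cong {N} x≗x′ j with j <? N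
... | yes j<N = x≗x′ (fromℕ< j<N)
... | no _ = refl

prefixMax-cong : ∀ {N} {x x′ : Fin N → ℕ} → x ≗ x′ → ∀ j → prefixMax x j ≡ prefixMax x′ j
prefixMax-cong x≗x′ zero = refl
prefixMax-cong x≗x′ (suc j) = cong₂ _⊔_ (prefixMax-cong x≗x′ j) (valueAt-cong x≗x′ j)

valueAt-suc : ∀ {N} (x : Fin (suc N) → ℕ) j → valueAt x (suc j) ≡ valueAt (x ∘ suc) j
valueAt-suc {N} x j with <-≤-connex j N
... | inj₁ j<N = trans (valueAt-fromℕ< x (s≤s j<N)) (sym (valueAt-fromℕ< (x ∘ suc) j<N))
... | inj₂ N≤j = trans (valueAt-outside x (≤⇒≯ (s≤s N≤j))) (sym (valueAt-outside (x ∘ suc) (≤⇒≯ N≤j)))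

prefixMax-suc : ∀ {N} (x : Fin (suc N) → ℕ) j → prefixMax x (suc j) ≡ x zero ⊔ prefixMax (x ∘ suc) j
prefixMax-suc x zero = sym (⊔-identityʳ _)
prefixMax-suc x (suc j) = begin
  prefixMax x (suc j) ⊔ valueAt x (suc j)             ≡⟨ cong₂ _⊔_ (prefixMax-suc x j) (valueAt-suc x j) ⟩
  (x zero ⊔ prefixMax (x ∘ suc) j) ⊔ valueAt (x ∘ suc) j ≡⟨ ⊔-assoc (x zero) _ _ ⟩
  x zero ⊔ prefixMax (x ∘ suc) (suc j)               ∎
  where open ≡-Reasoning

prefixMax-unchanged : ∀ {N} (x y : Fin N → ℕ) →
  (∀ q → y q ≡ x q ⊎ (x q ≤ prefixMax x (toℕ q) × y q ≤ prefixMax x (toℕ q))) →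
  ∀ j → prefixMax y j ≡ prefixMax x j
prefixMax-unchanged x y small zero = refl
prefixMax-unchanged {N} x y small (suc j) with <-≤-connex j N
... | inj₂ N≤j = cong₂ _⊔_ (prefixMax-unchanged x y small j)
                         (trans (valueAt-outside y (≤⇒≯ N≤j)) (sym (valueAt-outside x (≤⇒≯ N≤j))))
... | inj₁ j<N = begin
  prefixMax y j ⊔ valueAt y j  ≡⟨ cong₂ _⊔_ (prefixMax-unchanged x y small j) (valueAt-fromℕ< y j<N) ⟩
  prefixMax x j ⊔ y q          ≡⟨ step (small q) ⟩
  prefixMax x j ⊔ x q          ≡⟨ cong (prefixMax x j ⊔_) (valueAt-fromℕ< x j<N) ⟨
  prefixMax x j ⊔ valueAt x j  ∎
  where
  open ≡-Reasoning
  q : Fin N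
  q = fromℕ< j<N
  step : y q ≡ x q ⊎ (x q ≤ prefixMax x (toℕ q) × y q ≤ prefixMax x (toℕ q)) →
    prefixMax x j ⊔ y q ≡ prefixMax x j ⊔ x q
  step (inj₁ yq≡xq) = cong (prefixMax x j ⊔_) yq≡xq
  step (inj₂ (xq≤ , yq≤)) rewrite Finₚ.toℕ-fromℕ< j<N = trans (m≥n⇒m⊔n≡m yq≤) (sym (m≥n⇒m⊔n≡m xq≤))

RestrictedGrowthFun : ∀ {N} → (Fin N → ℕ) → Set
RestrictedGrowthFun x = ∀ q → 1 ≤ x q × x q ≤ suc (prefixMax x (toℕ q))

restrictedGrowth-cong : ∀ {N} {x x′ : Fin N → ℕ} → x ≗ x′ → RestrictedGrowthFun x → RestrictedGrowthFun x′
restrictedGrowth-cong x≗x′ rg q = subst (1 ≤_) (x≗x′ q) (proj₁ (rg q)) ,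
  subst₂ (λ u w → u ≤ suc w) (x≗x′ q) (prefixMax-cong x≗x′ (toℕ q)) (proj₂ (rg q))

prefixMax-attained : ∀ {N} (x : Fin N → ℕ) → RestrictedGrowthFun x → ∀ j {v} → 1 ≤ v → v ≤ prefixMax x j →
  ∃ λ q → toℕ q < j × x q ≡ v
prefixMax-attained x rg zero 1≤v v≤0 = contradiction (≤-trans 1≤v v≤0) λ ()
prefixMax-attained {N} x rg (suc j) {v} 1≤v v≤max with v ≤? prefixMax x j | j <? N
... | yes v≤ | _ = let (q , q<j , xq≡v) = prefixMax-attained x rg j 1≤v v≤ in q , m<n⇒m<1+n q<j , xq≡v
... | no v≰ | no j≮N = contradiction (subst (v ≤_) (⊔-identityʳ _) v≤max) v≰
... | no v≰ | yes j<N = q , s≤s (≤-reflexive toℕq≡j) , ≤-antisym xq≤v v≤xq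
  where
  q : Fin N
  q = fromℕ< j<N
  toℕq≡j : toℕ q ≡ j
  toℕq≡j = Finₚ.toℕ-fromℕ< j<N
  v≤xq : v ≤ x q
  v≤xq with ≤-total (prefixMax x j) (x q)
  ... | inj₁ max≤xq = subst (v ≤_) (m≤n⇒m⊔n≡n max≤xq) v≤max
  ... | inj₂ xq≤max = contradiction (subst (v ≤_) (m≥n⇒m⊔n≡m xq≤max) v≤max) v≰
  xq≤v : x q ≤ v
  xq≤v = ≤-trans (subst (λ z → x q ≤ suc (prefixMax x z)) toℕq≡j (proj₂ (rg q))) (≰⇒> v≰)

module _ {P : ℕ → Set} (P? : ∀ i → Dec (P i)) where

  greatest : ℕ → ℕ
  greatest zero = zero
  greatest (suc m) with P? (suc m)
  ... | yes _ = suc m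
  ... | no _ = greatest m

  greatest-≤ : ∀ m → greatest m ≤ m
  greatest-≤ zero = z≤n
  greatest-≤ (suc m) with P? (suc m)
  ... | yes _ = ≤-refl
  ... | no _ = m≤n⇒m≤1+n (greatest-≤ m)

  greatest-satisfies : ∀ m → 1 ≤ greatest m → P (greatest m)
  greatest-satisfies (suc m) 1≤g with P? (suc m)
  ... | yes p = p
  ... | no _ = greatest-satisfies m 1≤g

  ≤-greatest : ∀ m {i} → i ≤ m → P i → i ≤ greatest m
  ≤-greatest zero i≤0 _ = i≤0
  ≤-greatest (suc m) i≤m p with P? (suc m)
  ... | yes _ = i≤m
  ... | no ¬p with m≤n⇒m<n∨m≡n i≤m
  ...   | inj₁ (s≤s i≤m′) = ≤-greatest m i≤m′ p
  ...   | inj₂ refl = contradiction p ¬p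

greatest-cong : ∀ {P Q : ℕ → Set} (P? : ∀ i → Dec (P i)) (Q? : ∀ i → Dec (Q i)) →
  (∀ i → P i ⇔ Q i) → ∀ m → greatest P? m ≡ greatest Q? m
greatest-cong P? Q? P⇔Q zero = refl
greatest-cong P? Q? P⇔Q (suc m) with P? (suc m) | Q? (suc m)
... | yes _ | yes _ = refl
... | yes p | no ¬q = contradiction (Equivalence.to (P⇔Q _) p) ¬q
... | no ¬p | yes q = contradiction (Equivalence.from (P⇔Q _) q) ¬p
... | no _ | no _ = greatest-cong P? Q? P⇔Q m

module Heights {t : ℕ} (τ : Fin t → ℕ) where

  record TauAbove {N} (x : Fin N → ℕ) (p i : ℕ) : Set where
    constructor tauAbove
    field
      positions : Fin t → Fin N
      increasing : StrictlyIncreasingFin positions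
      rightOf : ∀ c → p < toℕ (positions c)
      above : ∀ c → i < x (positions c)
      isomorphic : OrderIsomorphic τ x positions

  tauAbove? : ∀ {N} (x : Fin N → ℕ) p i → Dec (TauAbove x p i)
  tauAbove? {N} x p i = map′ (λ (ι , inc , r , a , iso) → tauAbove ι inc r a iso)
    (λ (tauAbove ι inc r a iso) → ι , inc , r , a , iso)
    (anyFunction? Conditions respects λ ι → strictlyIncreasing? ι ×-dec (Finₚ.all? λ c → p <? toℕ (ι c)) ×-dec
                                 (Finₚ.all? λ c → i <? x (ι c)) ×-dec orderIsomorphic? τ x ι)
    where
    Conditions : (Fin t → Fin N) → Set
    Conditions ι = StrictlyIncreasingFin ι × (∀ c → p < toℕ (ι c)) × (∀ c → i < x (ι c)) × OrderIsomorphic τ x ι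
    respects : ∀ {ι ι′} → ι ≗ ι′ → Conditions ι → Conditions ι′
    respects ι≗ι′ (inc , r , a , iso) = strictlyIncreasing-resp ι≗ι′ inc ,
      (λ c → subst (λ q → p < toℕ q) (ι≗ι′ c) (r c)) , (λ c → subst (λ q → i < x q) (ι≗ι′ c) (a c)) ,
      orderIsomorphic-resp {g = x} ι≗ι′ iso

  tauAbove-lower : ∀ {N} {x : Fin N → ℕ} {p i i′} → i′ ≤ i → TauAbove x p i → TauAbove x p i′
  tauAbove-lower i′≤i (tauAbove ι inc r a iso) = tauAbove ι inc r (λ c → ≤-<-trans i′≤i (a c)) iso

  tauAbove-left : ∀ {N} {x : Fin N → ℕ} {p p′ i} → p′ ≤ p → TauAbove x p i → TauAbove x p′ i
  tauAbove-left p′≤p (tauAbove ι inc r a iso) = tauAbove ι inc (λ c → ≤-<-trans p′≤p (r c)) a iso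

  tauAbove-cong : ∀ {N} {x x′ : Fin N → ℕ} {p i} → x ≗ x′ → TauAbove x p i → TauAbove x′ p i
  tauAbove-cong {x = x} {x′} {i = i} x≗x′ (tauAbove ι inc r a iso) =
    tauAbove ι inc r (λ c → subst (i <_) (x≗x′ (ι c)) (a c)) (orderIsomorphic-congʳ {g = x} {x′} {ι} (x≗x′ ∘ ι) iso)

  -- opaque: unfolding height would run the exhaustive search for τ during type checking
  opaque

    height : ∀ {N} → (Fin N → ℕ) → ℕ → ℕ
    height x p = greatest (tauAbove? x p) (prefixMax x p)

    height≤prefixMax : ∀ {N} (x : Fin N → ℕ) p → height x p ≤ prefixMax x p
    height≤prefixMax x p = greatest-≤ (tauAbove? x p) (prefixMax x p)

    ≤-height⇒tauAbove : ∀ {N} (x : Fin N → ℕ) p {i} → 1 ≤ i → i ≤ height x p → TauAbove x p i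
    ≤-height⇒tauAbove x p 1≤i i≤h =
      tauAbove-lower i≤h (greatest-satisfies (tauAbove? x p) (prefixMax x p) (≤-trans 1≤i i≤h))

    tauAbove⇒≤-height : ∀ {N} (x : Fin N → ℕ) p {i} → i ≤ prefixMax x p → TauAbove x p i → i ≤ height x p
    tauAbove⇒≤-height x p = ≤-greatest (tauAbove? x p) (prefixMax x p)

    height-cong : ∀ {N} {x x′ : Fin N → ℕ} {p} → prefixMax x p ≡ prefixMax x′ p →
      (∀ i → TauAbove x p i ⇔ TauAbove x′ p i) → height x p ≡ height x′ p
    height-cong {x = x} {x′} {p} max≡ x⇔x′ = begin
      greatest (tauAbove? x p) (prefixMax x p)   ≡⟨ cong (greatest (tauAbove? x p)) max≡ ⟩
      greatest (tauAbove? x p) (prefixMax x′ p)  ≡⟨ greatest-cong (tauAbove? x p) (tauAbove? x′ p) x⇔x′ (prefixMax x′ p) ⟩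
      greatest (tauAbove? x′ p) (prefixMax x′ p) ∎
      where open ≡-Reasoning

  height-resp : ∀ {N} {x x′ : Fin N → ℕ} → x ≗ x′ → ∀ p → height x p ≡ height x′ p
  height-resp x≗x′ p =
    height-cong (prefixMax-cong x≗x′ p) λ i → mk⇔ (tauAbove-cong x≗x′) (tauAbove-cong (sym ∘ x≗x′))

  height-interval : ∀ {N} (x : Fin N → ℕ) {p₁ p₂ p₃} → p₁ ≤ p₂ → p₂ ≤ p₃ →
    height x p₁ ⊓ height x p₃ ≤ height x p₂
  height-interval x {p₁} {p₂} {p₃} p₁≤p₂ p₂≤p₃ with height x p₁ ⊓ height x p₃ in min≡v
  ... | zero = z≤n
  ... | suc v = tauAbove⇒≤-height x p₂
    (≤-trans (≤-trans v≤h₁ (height≤prefixMax x p₁)) (prefixMax-mono x p₁≤p₂))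
    (tauAbove-left p₂≤p₃ (≤-height⇒tauAbove x p₃ (s≤s z≤n) v≤h₃))
    where
    v≤h₁ : suc v ≤ height x p₁
    v≤h₁ = subst (_≤ height x p₁) min≡v (m⊓n≤m _ _)
    v≤h₃ : suc v ≤ height x p₃
    v≤h₃ = subst (_≤ height x p₃) min≡v (m⊓n≤n _ _)

does≡true⇒ : ∀ {A : Set} (a? : Dec A) → does a? ≡ true → A
does≡true⇒ (yes a) _ = a

Fits : ℕ → ℕ → Set
Fits v h = 1 ≤ v × v ≤ h

fits? : ∀ v h → Dec (Fits v h)
fits? v h = 1 ≤? v ×-dec v ≤? h

fitsᵇ : ℕ → ℕ → Bool
fitsᵇ v h = does (fits? v h)

fits⇒pred< : ∀ {v h} → Fits v h → pred v < h
fits⇒pred< {suc v} (_ , v<h) = v<h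

unitColumn : (h u : ℕ) → Vec Bool h
unitColumn zero u = []
unitColumn (suc h) zero = true ∷ Vec.replicate h false
unitColumn (suc h) (suc u) = false ∷ unitColumn h u

firstOne : List Bool → ℕ
firstOne [] = 0
firstOne (true ∷ _) = 0
firstOne (false ∷ bs) = suc (firstOne bs)

ones-replicate : ∀ h → ones (Vec.replicate h false) ≡ 0
ones-replicate zero = refl
ones-replicate (suc h) = ones-replicate h

ones≡0⇒replicate : ∀ {h} (v : Vec Bool h) → ones v ≡ 0 → v ≡ Vec.replicate h false
ones≡0⇒replicate [] _ = refl
ones≡0⇒replicate (false ∷ v) none = cong (false ∷_) (ones≡0⇒replicate v none)

ones-unitColumn : ∀ {h u} → u < h → ones (unitColumn h u) ≡ 1
ones-unitColumn {suc h} {zero} _ = cong suc (ones-replicate h)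
ones-unitColumn {suc h} {suc u} (s≤s u<h) = ones-unitColumn u<h

firstOne-unitColumn : ∀ {h u} → u < h → firstOne (Vec.toList (unitColumn h u)) ≡ u
firstOne-unitColumn {suc h} {zero} _ = refl
firstOne-unitColumn {suc h} {suc u} (s≤s u<h) = cong suc (firstOne-unitColumn u<h)

firstOne<height : ∀ {h} (v : Vec Bool h) → ones v ≡ 1 → firstOne (Vec.toList v) < h
firstOne<height (true ∷ v) _ = s≤s z≤n
firstOne<height (false ∷ v) one = s≤s (firstOne<height v one)

unitColumn-firstOne : ∀ {h} (v : Vec Bool h) → ones v ≡ 1 → unitColumn h (firstOne (Vec.toList v)) ≡ v
unitColumn-firstOne (true ∷ v) one = cong (true ∷_) (sym (ones≡0⇒replicate v (suc-injective one)))
unitColumn-firstOne (false ∷ v) one = cong (false ∷_) (unitColumn-firstOne v one)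

lookup-unitColumn : ∀ {h u} (j : Fin h) → Vec.lookup (unitColumn h u) j ≡ true → toℕ j ≡ u
lookup-unitColumn {suc h} {zero} zero _ = refl
lookup-unitColumn {suc h} {zero} (suc j) isOne =
  contradiction (trans (sym (Vecₚ.lookup-replicate j false)) isOne) λ ()
lookup-unitColumn {suc h} {suc u} (suc j) isOne = cong suc (lookup-unitColumn j isOne)

lookup-unitColumn-self : ∀ {h u} (j : Fin h) → toℕ j ≡ u → Vec.lookup (unitColumn h u) j ≡ true
lookup-unitColumn-self {suc h} zero refl = refl
lookup-unitColumn-self {suc h} (suc j) refl = lookup-unitColumn-self j refl

cell : ∀ {h} → Vec Bool h → ℕ → Bool
cell {h} v r with r <? h
... | yes r<h = Vec.lookup v (fromℕ< r<h)
... | no _ = false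

cell-unitColumn : ∀ {h u r} → cell (unitColumn h u) r ≡ true → r ≡ u
cell-unitColumn {h} {u} {r} isOne with r <? h
... | yes r<h = trans (sym (Finₚ.toℕ-fromℕ< r<h)) (lookup-unitColumn (fromℕ< r<h) isOne)

cell-unitColumn-self : ∀ {h u} → u < h → cell (unitColumn h u) u ≡ true
cell-unitColumn-self {h} {u} u<h with u <? h
... | yes u<h′ = lookup-unitColumn-self (fromℕ< u<h′) (Finₚ.toℕ-fromℕ< u<h′)
... | no u≮h = contradiction u<h u≮h

entry-zero : ∀ {h hs} (v : Vec Bool h) (F : Filling hs) r → entry (v ∷ F) zero r ≡ cell v r
entry-zero {h} v F r with r <? h
... | yes _ = refl
... | no _ = refl

prependIf : Bool → ℕ → List ℕ → List ℕ
prependIf true a l = a ∷ l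
prependIf false a l = l

shape : ∀ {N} → (Fin N → Bool) → (Fin N → ℕ) → List ℕ
shape {zero} D h = []
shape {suc N} D h = prependIf (D zero) (h zero) (shape (D ∘ suc) (h ∘ suc))

columnStep : ∀ b {a l N} → (Fin (length l) → Fin N) → Fin (length (prependIf b a l)) → Fin (suc N)
columnStep true f zero = zero
columnStep true f (suc c) = suc (f c)
columnStep false f c = suc (f c)

column : ∀ {N} (D : Fin N → Bool) (h : Fin N → ℕ) → Fin (length (shape D h)) → Fin N
column {suc N} D h = columnStep (D zero) (column (D ∘ suc) (h ∘ suc))

consIf : ∀ b {a l} → Vec Bool a → Filling l → Filling (prependIf b a l)
consIf true v F = v ∷ F
consIf false v F = F

-- the column at position q has its 1 in row x q - 1
encode : ∀ {N} (D : Fin N → Bool) (h x : Fin N → ℕ) → Filling (shape D h)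
encode {zero} D h x = []
encode {suc N} D h x =
  consIf (D zero) (unitColumn (h zero) (pred (x zero))) (encode (D ∘ suc) (h ∘ suc) (x ∘ suc))

dropIf : ∀ b {a l} → Filling (prependIf b a l) → Filling l
dropIf true (v ∷ F) = F
dropIf false F = F

decodeHead : ∀ b {a l} → ℕ → Filling (prependIf b a l) → ℕ
decodeHead true v (col ∷ F) = suc (firstOne (Vec.toList col))
decodeHead false v F = v

decode : ∀ {N} (D : Fin N → Bool) (h x : Fin N → ℕ) → Filling (shape D h) → Fin N → ℕ
decode {suc N} D h x F zero = decodeHead (D zero) (x zero) F
decode {suc N} D h x F (suc q) = decode (D ∘ suc) (h ∘ suc) (x ∘ suc) (dropIf (D zero) F) q

toLists : ∀ {hs} → Filling hs → List (List Bool)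
toLists [] = []
toLists (v ∷ F) = Vec.toList v ∷ toLists F

lookup-shape : ∀ {N} (D : Fin N → Bool) h (c : Fin (length (shape D h))) →
  List.lookup (shape D h) c ≡ h (column D h c)
lookup-shape {suc N} D h with D zero
... | true = λ { zero → refl ; (suc c) → lookup-shape (D ∘ suc) (h ∘ suc) c }
... | false = lookup-shape (D ∘ suc) (h ∘ suc)

column-selected : ∀ {N} (D : Fin N → Bool) h (c : Fin (length (shape D h))) → D (column D h c) ≡ true
column-selected {suc N} D h with D zero in selected
... | true = λ { zero → selected ; (suc c) → column-selected (D ∘ suc) (h ∘ suc) c }
... | false = column-selected (D ∘ suc) (h ∘ suc)

column-surjective : ∀ {N} (D : Fin N → Bool) h {q} → D q ≡ true → ∃ λ c → column D h c ≡ q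
column-surjective {suc N} D h {q} selected with D zero in selected₀ | q
... | true | zero = zero , refl
... | false | zero = contradiction (trans (sym selected) selected₀) λ ()
... | true | suc q′ = let (c , col≡q′) = column-surjective (D ∘ suc) (h ∘ suc) selected in suc c , cong suc col≡q′
... | false | suc q′ = let (c , col≡q′) = column-surjective (D ∘ suc) (h ∘ suc) selected in c , cong suc col≡q′

column-increasing : ∀ {N} (D : Fin N → Bool) h → StrictlyIncreasingFin (column D h)
column-increasing {suc N} D h with D zero
... | true = λ { zero (suc c′) _ → s≤s z≤n
               ; (suc c) (suc c′) (s≤s c<c′) → s≤s (column-increasing (D ∘ suc) (h ∘ suc) c c′ c<c′) }
... | false = λ c c′ c<c′ → s≤s (column-increasing (D ∘ suc) (h ∘ suc) c c′ c<c′)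

entry-encode : ∀ {N} (D : Fin N → Bool) h x (c : Fin (length (shape D h))) r →
  entry (encode D h x) c r ≡ cell (unitColumn (h (column D h c)) (pred (x (column D h c)))) r
entry-encode {suc N} D h x with D zero
... | true = λ { zero r → entry-zero (unitColumn (h zero) (pred (x zero))) (encode (D ∘ suc) (h ∘ suc) (x ∘ suc)) r
               ; (suc c) r → entry-encode (D ∘ suc) (h ∘ suc) (x ∘ suc) c r }
... | false = entry-encode (D ∘ suc) (h ∘ suc) (x ∘ suc)

encode-semiStandard : ∀ {N} (D : Fin N → Bool) h x → (∀ q → D q ≡ true → Fits (x q) (h q)) →
  SemiStandard (encode D h x)
encode-semiStandard {zero} D h x _ = tt
encode-semiStandard {suc N} D h x fits with D zero in selected
... | true = ones-unitColumn (fits⇒pred< (fits zero selected)) ,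
             encode-semiStandard (D ∘ suc) (h ∘ suc) (x ∘ suc) (fits ∘ suc)
... | false = encode-semiStandard (D ∘ suc) (h ∘ suc) (x ∘ suc) (fits ∘ suc)

semiStandard-dropIf : ∀ b {a l} (F : Filling (prependIf b a l)) → SemiStandard F → SemiStandard (dropIf b F)
semiStandard-dropIf true (v ∷ F) (_ , ss) = ss
semiStandard-dropIf false F ss = ss

decode-encode : ∀ {N} (D : Fin N → Bool) h x → (∀ q → D q ≡ true → Fits (x q) (h q)) →
  decode D h x (encode D h x) ≗ x
decode-encode {suc N} D h x fits zero with D zero in selected
... | true = let fits₀ = fits zero selected in
  trans (cong suc (firstOne-unitColumn (fits⇒pred< fits₀))) (suc-pred _ {{>-nonZero (proj₁ fits₀)}})
... | false = refl
decode-encode {suc N} D h x fits (suc q) with D zero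
... | true = decode-encode (D ∘ suc) (h ∘ suc) (x ∘ suc) (fits ∘ suc) q
... | false = decode-encode (D ∘ suc) (h ∘ suc) (x ∘ suc) (fits ∘ suc) q

decode-unselected : ∀ {N} (D : Fin N → Bool) h x (F : Filling (shape D h)) q → D q ≡ false → decode D h x F q ≡ x q
decode-unselected {suc N} D h x F zero unselected with D zero
decode-unselected {suc N} D h x F zero refl | false = refl
decode-unselected {suc N} D h x F (suc q) unselected =
  decode-unselected (D ∘ suc) (h ∘ suc) (x ∘ suc) (dropIf (D zero) F) q unselected

decode-fits : ∀ {N} (D : Fin N → Bool) h x (F : Filling (shape D h)) → SemiStandard F →
  ∀ q → D q ≡ true → Fits (decode D h x F q) (h q)
decode-fits {suc N} D h x F ss zero selected with D zero | F | ss
decode-fits {suc N} D h x F ss zero refl | true | col ∷ _ | (one , _) = s≤s z≤n , firstOne<height col one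
decode-fits {suc N} D h x F ss (suc q) selected =
  decode-fits (D ∘ suc) (h ∘ suc) (x ∘ suc) (dropIf (D zero) F) (semiStandard-dropIf (D zero) F ss) q selected

shape-cong : ∀ {N} {D D′ : Fin N → Bool} {h h′ : Fin N → ℕ} → D ≗ D′ → h ≗ h′ → shape D h ≡ shape D′ h′
shape-cong {zero} D≗D′ h≗h′ = refl
shape-cong {suc N} D≗D′ h≗h′ rewrite D≗D′ zero | h≗h′ zero =
  cong (prependIf _ _) (shape-cong (D≗D′ ∘ suc) (h≗h′ ∘ suc))

encode-cong : ∀ {N} {D D′ : Fin N → Bool} {h h′ x x′ : Fin N → ℕ} → D ≗ D′ → h ≗ h′ → x ≗ x′ →
  toLists (encode D h x) ≡ toLists (encode D′ h′ x′)
encode-cong {zero} D≗D′ h≗h′ x≗x′ = refl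
encode-cong {suc N} {D′ = D′} D≗D′ h≗h′ x≗x′
  rewrite D≗D′ zero | h≗h′ zero | x≗x′ zero with D′ zero
... | true = cong (_ ∷_) (encode-cong (D≗D′ ∘ suc) (h≗h′ ∘ suc) (x≗x′ ∘ suc))
... | false = encode-cong (D≗D′ ∘ suc) (h≗h′ ∘ suc) (x≗x′ ∘ suc)

encode-decode : ∀ {N} (D : Fin N → Bool) {h h′ : Fin N → ℕ} x (F : Filling (shape D h)) → h ≗ h′ →
  SemiStandard F → toLists (encode D h′ (decode D h x F)) ≡ toLists F
encode-decode {zero} D x [] h≗h′ ss = refl
encode-decode {suc N} D {h} {h′} x F h≗h′ ss with D zero | F | ss
... | true | col ∷ F′ | (one , ss′) =
  cong₂ _∷_ (trans (cong (λ a → Vec.toList (unitColumn a (firstOne (Vec.toList col)))) (sym (h≗h′ zero)))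
                   (cong Vec.toList (unitColumn-firstOne col one)))
            (encode-decode (D ∘ suc) (x ∘ suc) F′ (h≗h′ ∘ suc) ss′)
... | false | F′ | ss′ = encode-decode (D ∘ suc) (x ∘ suc) F′ (h≗h′ ∘ suc) ss′

decode-cong : ∀ {N} {D D′ : Fin N → Bool} {h h′ x x′ : Fin N → ℕ}
  (G : Filling (shape D h)) (G′ : Filling (shape D′ h′)) → D ≗ D′ → (∀ q → D q ≡ false → x q ≡ x′ q) →
  toLists G ≡ toLists G′ → decode D h x G ≗ decode D′ h′ x′ G′
decode-cong {suc N} {D} {D′} G G′ D≗D′ agree G≡G′ zero with D zero in selected | D′ zero | D≗D′ zero | G | G′
... | true | _ | refl | col ∷ _ | col′ ∷ _ = cong (suc ∘ firstOne) (Listₚ.∷-injectiveˡ G≡G′)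
... | false | _ | refl | _ | _ = agree zero selected
decode-cong {suc N} {D} {D′} G G′ D≗D′ agree G≡G′ (suc q) with D zero | D′ zero | D≗D′ zero | G | G′
... | true | _ | refl | _ ∷ H | _ ∷ H′ = decode-cong H H′ (D≗D′ ∘ suc) (agree ∘ suc) (Listₚ.∷-injectiveʳ G≡G′) q
... | false | _ | refl | H | H′ = decode-cong H H′ (D≗D′ ∘ suc) (agree ∘ suc) G≡G′ q

toLists-subst : ∀ {hs hs′} (hs≡hs′ : hs ≡ hs′) (F : Filling hs) → toLists (subst Filling hs≡hs′ F) ≡ toLists F
toLists-subst refl F = refl

toLists-injective : ∀ {hs} (F F′ : Filling hs) → toLists F ≡ toLists F′ → F ≡ F′
toLists-injective [] [] _ = refl
toLists-injective (v ∷ F) (v′ ∷ F′) F≡F′ =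
  cong₂ _∷_ (trans (sym (Vecₚ.cast-is-id refl v)) (Vecₚ.toList-injective refl v v′ (Listₚ.∷-injectiveˡ F≡F′)))
            (toLists-injective F F′ (Listₚ.∷-injectiveʳ F≡F′))

shape-all : ∀ {N} {P : ℕ → Set} (D : Fin N → Bool) h → (∀ q → D q ≡ true → P (h q)) → All P (shape D h)
shape-all {zero} D h _ = []
shape-all {suc N} D h selected⇒P with D zero in selected
... | true = selected⇒P zero selected ∷ shape-all (D ∘ suc) (h ∘ suc) (selected⇒P ∘ suc)
... | false = shape-all (D ∘ suc) (h ∘ suc) (selected⇒P ∘ suc)

module Columns {t : ℕ} (τ : Fin t → ℕ) where

  open Heights τ

  -- An occurrence through a selected position q can be replaced by one to the right of q
  -- above x q, and x q exceeds i; positions strictly increase, so this terminates.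
  tauAbove-avoiding : ∀ {N} {x : Fin N → ℕ} (D : Fin N → Bool) {p i} →
    (∀ q → p < toℕ q → D q ≡ true → TauAbove x (toℕ q) (x q)) →
    TauAbove x p i → Σ (TauAbove x p i) λ occ → ∀ c → D (TauAbove.positions occ c) ≡ false
  tauAbove-avoiding {N} {x} D {p} selected⇒tau = go N p ≤-refl (m≤m+n N p) selected⇒tau
    where
    go : ∀ fuel p′ {i} → p ≤ p′ → N ≤ fuel + p′ →
      (∀ q → p′ < toℕ q → D q ≡ true → TauAbove x (toℕ q) (x q)) →
      TauAbove x p′ i → Σ (TauAbove x p′ i) λ occ → ∀ c → D (TauAbove.positions occ c) ≡ false
    go fuel p′ p≤p′ bound hyp occ@(tauAbove ι inc right above iso) with Finₚ.any? (λ c → D (ι c) Boolₚ.≟ true)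
    ... | no none = occ , λ c → Boolₚ.¬-not (λ selected → none (c , selected))
    ... | yes (c , selected) with fuel
    ...   | zero = contradiction (≤-<-trans bound (right c)) (<-asym (Finₚ.toℕ<n (ι c)))
    ...   | suc fuel′ =
      let (occ′ , avoids) = go fuel′ (toℕ (ι c)) (≤-trans p≤p′ (<⇒≤ (right c)))
                             (≤-trans bound (subst (_≤ fuel′ + toℕ (ι c)) (+-suc fuel′ p′) (+-monoʳ-≤ fuel′ (right c))))
                             (λ q ιc<q → hyp q (<-trans (right c) ιc<q))
                             (hyp (ι c) (right c) selected)
      in tauAbove-lower (<⇒≤ (above c)) (tauAbove-left (<⇒≤ (right c)) occ′) , avoids

  tauAbove-transfer : ∀ {N} {x y : Fin N → ℕ} (D : Fin N → Bool) {p i} →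
    (∀ q → p < toℕ q → D q ≡ true → TauAbove x (toℕ q) (x q)) →
    (∀ q → D q ≡ false → x q ≡ y q) → TauAbove x p i → TauAbove y p i
  tauAbove-transfer {x = x} {y} D {i = i} selected⇒tau agree occ with tauAbove-avoiding D selected⇒tau occ
  ... | tauAbove ι inc right above iso , avoids =
    tauAbove ι inc right (λ c → subst (i <_) (agree′ c) (above c)) (orderIsomorphic-congʳ {g = x} {y} {ι} agree′ iso)
    where
    agree′ : ∀ c → x (ι c) ≡ y (ι c)
    agree′ c = agree (ι c) (avoids c)

  columnHeight : ∀ {N} → (Fin N → ℕ) → Fin N → ℕ
  columnHeight x q = height x (toℕ q)

  active : ∀ {N} → (Fin N → ℕ) → Fin N → Bool
  active x q = fitsᵇ (x q) (columnHeight x q)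

  columnHeight-resp : ∀ {N} {x x′ : Fin N → ℕ} → x ≗ x′ → columnHeight x ≗ columnHeight x′
  columnHeight-resp x≗x′ q = height-resp x≗x′ (toℕ q)

  active-resp : ∀ {N} {x x′ : Fin N → ℕ} → x ≗ x′ → active x ≗ active x′
  active-resp x≗x′ q = cong₂ fitsᵇ (x≗x′ q) (columnHeight-resp x≗x′ q)

  active⇒fits : ∀ {N} (x : Fin N → ℕ) {q} → active x q ≡ true → Fits (x q) (columnHeight x q)
  active⇒fits x {q} = does≡true⇒ (fits? (x q) (columnHeight x q))

  shapeOf : ∀ {N} → (Fin N → ℕ) → List ℕ
  shapeOf x = shape (active x) (columnHeight x)

  fillingOf : ∀ {N} (x : Fin N → ℕ) → Filling (shapeOf x)
  fillingOf x = encode (active x) (columnHeight x) x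

  fillingOf-semiStandard : ∀ {N} (x : Fin N → ℕ) → SemiStandard (fillingOf x)
  fillingOf-semiStandard x = encode-semiStandard (active x) (columnHeight x) x (λ q → active⇒fits x)

  shapeOf-stack : ∀ {N} (x : Fin N → ℕ) → IsStackPolyomino (shapeOf x)
  shapeOf-stack x = shape-all (active x) (columnHeight x) (λ q → positive ∘ active⇒fits x) , interval
    where
    positive : ∀ {v h} → Fits v h → 1 ≤ h
    positive (1≤v , v≤h) = ≤-trans 1≤v v≤h
    heightAt : Fin (length (shapeOf x)) → ℕ
    heightAt = List.lookup (shapeOf x)
    interval : ∀ c₁ c₂ c₃ → c₁ Fin.< c₂ → c₂ Fin.< c₃ → heightAt c₁ ⊓ heightAt c₃ ≤ heightAt c₂
    interval c₁ c₂ c₃ c₁<c₂ c₂<c₃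
      rewrite lookup-shape (active x) (columnHeight x) c₁ | lookup-shape (active x) (columnHeight x) c₂
            | lookup-shape (active x) (columnHeight x) c₃ =
      height-interval x (<⇒≤ (column-increasing (active x) (columnHeight x) c₁ c₂ c₁<c₂))
                        (<⇒≤ (column-increasing (active x) (columnHeight x) c₂ c₃ c₂<c₃))

  module Decoding {N} (x : Fin N → ℕ) (F : Filling (shapeOf x)) (ss : SemiStandard F) where

    y : Fin N → ℕ
    y = decode (active x) (columnHeight x) x F

    y-inactive : ∀ q → active x q ≡ false → y q ≡ x q
    y-inactive = decode-unselected (active x) (columnHeight x) x F

    y-active : ∀ q → active x q ≡ true → Fits (y q) (columnHeight x q)
    y-active = decode-fits (active x) (columnHeight x) x F ss

    -- active values are at most the height, hence at most the prefix maximum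
    prefixMax-y : ∀ j → prefixMax y j ≡ prefixMax x j
    prefixMax-y = prefixMax-unchanged x y small
      where
      small : ∀ q → y q ≡ x q ⊎ (x q ≤ prefixMax x (toℕ q) × y q ≤ prefixMax x (toℕ q))
      small q with active x q in isActive
      ... | false = inj₁ (y-inactive q isActive)
      ... | true = inj₂ (≤-trans (proj₂ (active⇒fits x isActive)) (height≤prefixMax x (toℕ q)) ,
                         ≤-trans (proj₂ (y-active q isActive)) (height≤prefixMax x (toℕ q)))

    heightStep : ∀ p → (∀ q → p < toℕ q → columnHeight y q ≡ columnHeight x q) → height y p ≡ height x p
    heightStep p heights≡ = height-cong (prefixMax-y p) y⇔x
      where
      y⇔x : ∀ i → TauAbove y p i ⇔ TauAbove x p i
      y⇔x i = mk⇔
        (tauAbove-transfer (active x)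
          (λ q p<q isActive → let (1≤y , y≤h) = y-active q isActive in
            ≤-height⇒tauAbove y (toℕ q) 1≤y (subst (y q ≤_) (sym (heights≡ q p<q)) y≤h))
          y-inactive)
        (tauAbove-transfer (active x)
          (λ q _ isActive → let (1≤x , x≤h) = active⇒fits x isActive in ≤-height⇒tauAbove x (toℕ q) 1≤x x≤h)
          (λ q isInactive → sym (y-inactive q isInactive)))

    heightsFrom : ∀ fuel p → N ≤ fuel + p → height y p ≡ height x p
    heightsFrom zero p N≤p = heightStep p λ q p<q → contradiction (≤-<-trans N≤p p<q) (<-asym (Finₚ.toℕ<n q))
    heightsFrom (suc fuel) p bound = heightStep p λ q p<q →
      heightsFrom fuel (toℕ q) (≤-trans bound (subst (_≤ fuel + toℕ q) (+-suc fuel p) (+-monoʳ-≤ fuel p<q)))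

    columnHeight-y : ∀ q → columnHeight y q ≡ columnHeight x q
    columnHeight-y q = heightsFrom N (toℕ q) (m≤m+n N (toℕ q))

    active-y : ∀ q → active y q ≡ active x q
    active-y q with active x q in isActive
    ... | true = dec-true (fits? (y q) (columnHeight y q))
                   (subst (Fits (y q)) (sym (columnHeight-y q)) (y-active q isActive))
    ... | false = trans (cong₂ fitsᵇ (y-inactive q isActive) (columnHeight-y q)) isActive

    shapeOf-y : shapeOf y ≡ shapeOf x
    shapeOf-y = shape-cong active-y columnHeight-y

    fillingOf-y : toLists (fillingOf y) ≡ toLists F
    fillingOf-y = trans (encode-cong active-y (λ _ → refl) (λ _ → refl))
                        (encode-decode (active x) x F (sym ∘ columnHeight-y) ss)

    restrictedGrowth-y : RestrictedGrowthFun x → RestrictedGrowthFun y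
    restrictedGrowth-y rg q rewrite prefixMax-y (toℕ q) with active x q in isActive
    ... | false rewrite y-inactive q isActive = rg q
    ... | true = let (1≤y , y≤h) = y-active q isActive in
      1≤y , m≤n⇒m≤1+n (≤-trans y≤h (height≤prefixMax x (toℕ q)))

-- lookup by a natural number, 0 past the end; this avoids casts between Fin (length σ) and Fin (k + (m + t))
nth : List ℕ → ℕ → ℕ
nth [] j = 0
nth (a ∷ l) zero = a
nth (a ∷ l) (suc j) = nth l j

lookup≡nth : ∀ l (i : Fin (length l)) → List.lookup l i ≡ nth l (toℕ i)
lookup≡nth (a ∷ l) zero = refl
lookup≡nth (a ∷ l) (suc i) = lookup≡nth l i

nth-++ˡ : ∀ xs ys {j} → j < length xs → nth (xs ++ ys) j ≡ nth xs j
nth-++ˡ (a ∷ xs) ys {zero} _ = refl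
nth-++ˡ (a ∷ xs) ys {suc j} (s≤s j<) = nth-++ˡ xs ys j<

nth-++ʳ : ∀ xs ys j → nth (xs ++ ys) (length xs + j) ≡ nth ys j
nth-++ʳ [] ys j = refl
nth-++ʳ (a ∷ xs) ys j = nth-++ʳ xs ys j

nth-map : ∀ (f : ℕ → ℕ) l {j} → j < length l → nth (map f l) j ≡ f (nth l j)
nth-map f (a ∷ l) {zero} _ = refl
nth-map f (a ∷ l) {suc j} (s≤s j<) = nth-map f l j<

nth-applyUpTo : ∀ (f : ℕ → ℕ) n {j} → j < n → nth (applyUpTo f n) j ≡ f j
nth-applyUpTo f (suc n) {zero} _ = refl
nth-applyUpTo f (suc n) {suc j} (s≤s j<n) = nth-applyUpTo (f ∘ suc) n j<n

length-ascending : ∀ k → length (ascending k) ≡ k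
length-ascending k = trans (Listₚ.length-map suc (upTo k)) (Listₚ.length-upTo k)

nth-ascending : ∀ k {j} → j < k → nth (ascending k) j ≡ suc j
nth-ascending k {j} j<k =
  trans (nth-map suc (upTo k) (subst (j <_) (sym (Listₚ.length-upTo k)) j<k)) (cong suc (nth-applyUpTo id k j<k))

glue : ∀ {k m t} {A : Set} → (Fin k → A) → (Fin m → A) → (Fin t → A) → Fin (k + (m + t)) → A
glue {k} {m} fa fs ft i = [ fa , [ fs , ft ]′ ∘ splitAt m ]′ (splitAt k i)

glue-first : ∀ {k m t} {A : Set} (fa : Fin k → A) (fs : Fin m → A) (ft : Fin t → A) a →
  glue fa fs ft (a ↑ˡ (m + t)) ≡ fa a
glue-first {k} {m} {t} fa fs ft a = cong [ fa , [ fs , ft ]′ ∘ splitAt m ]′ (Finₚ.splitAt-↑ˡ k a (m + t))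

glue-middle : ∀ {k m t} {A : Set} (fa : Fin k → A) (fs : Fin m → A) (ft : Fin t → A) b →
  glue fa fs ft (k ↑ʳ (b ↑ˡ t)) ≡ fs b
glue-middle {k} {m} {t} fa fs ft b rewrite Finₚ.splitAt-↑ʳ k (m + t) (b ↑ˡ t) = cong [ fs , ft ]′ (Finₚ.splitAt-↑ˡ m b t)

glue-last : ∀ {k m t} {A : Set} (fa : Fin k → A) (fs : Fin m → A) (ft : Fin t → A) c →
  glue fa fs ft (k ↑ʳ (m ↑ʳ c)) ≡ ft c
glue-last {k} {m} {t} fa fs ft c rewrite Finₚ.splitAt-↑ʳ k (m + t) (m ↑ʳ c) = cong [ fs , ft ]′ (Finₚ.splitAt-↑ʳ m t c)

data Segment (k m t : ℕ) : Fin (k + (m + t)) → Set where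
  first : (a : Fin k) → Segment k m t (a ↑ˡ (m + t))
  middle : (b : Fin m) → Segment k m t (k ↑ʳ (b ↑ˡ t))
  last : (c : Fin t) → Segment k m t (k ↑ʳ (m ↑ʳ c))

segment : ∀ {k m t} i → Segment k m t i
segment {k} {m} {t} i with splitAt k i in split
... | inj₁ a = subst (Segment k m t) (Finₚ.splitAt⁻¹-↑ˡ split) (first a)
... | inj₂ j with splitAt m j in split′
...   | inj₁ b = subst (Segment k m t)
                   (trans (cong (k ↑ʳ_) (Finₚ.splitAt⁻¹-↑ˡ split′)) (Finₚ.splitAt⁻¹-↑ʳ split)) (middle b)
...   | inj₂ c = subst (Segment k m t)
                   (trans (cong (k ↑ʳ_) (Finₚ.splitAt⁻¹-↑ʳ split′)) (Finₚ.splitAt⁻¹-↑ʳ split)) (last c)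

↑ˡ<↑ʳ : ∀ {k n} (a : Fin k) (j : Fin n) → a ↑ˡ n Fin.< k ↑ʳ j
↑ˡ<↑ʳ {k} {n} a j rewrite Finₚ.toℕ-↑ˡ a n | Finₚ.toℕ-↑ʳ k j = ≤-trans (Finₚ.toℕ<n a) (m≤m+n k _)

↑ˡ-<⇔ : ∀ {k} n {a a′ : Fin k} → (a ↑ˡ n Fin.< a′ ↑ˡ n) ⇔ (a Fin.< a′)
↑ˡ-<⇔ n {a} {a′} rewrite Finₚ.toℕ-↑ˡ a n | Finₚ.toℕ-↑ˡ a′ n = mk⇔ id id

↑ʳ-<⇔ : ∀ k {n} {j j′ : Fin n} → (k ↑ʳ j Fin.< k ↑ʳ j′) ⇔ (j Fin.< j′)
↑ʳ-<⇔ k {j = j} {j′} rewrite Finₚ.toℕ-↑ʳ k j | Finₚ.toℕ-↑ʳ k j′ = mk⇔ (+-cancelˡ-< k _ _) (+-monoʳ-< k)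

strictlyIncreasing-factor : ∀ {m n N} {f : Fin n → Fin N} {g : Fin m → Fin n} {h : Fin m → Fin N} →
  (∀ b → f (g b) ≡ h b) → StrictlyIncreasingFin f → StrictlyIncreasingFin h → StrictlyIncreasingFin g
strictlyIncreasing-factor {f = f} {g} {h} f∘g≗h f-inc h-inc b b′ b<b′ with g b Finₚ.<? g b′
... | yes gb<gb′ = gb<gb′
... | no gb≮gb′ = contradiction (h-inc b b′ b<b′) (≤⇒≯ (subst₂ (λ u v → toℕ u ≤ toℕ v) (f∘g≗h b′) (f∘g≗h b)
                      (strictlyIncreasing-mono {f = toℕ ∘ f} f-inc (g b′) (g b) (≮⇒≥ gb≮gb′))))

firstSatisfying : ∀ {N} {P : Fin N → Set} → (∀ q → Dec (P q)) → ∃ P →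
  ∃ λ q → P q × (∀ q′ → P q′ → toℕ q ≤ toℕ q′)
firstSatisfying {suc N} P? (q₀ , Pq₀) with P? zero
... | yes P0 = zero , P0 , λ _ _ → z≤n
... | no ¬P0 with q₀
...   | zero = contradiction Pq₀ ¬P0
...   | suc q₀′ = let (q , Pq , least) = firstSatisfying (P? ∘ suc) (q₀′ , Pq₀) in
  suc q , Pq , λ { zero P0 → contradiction P0 ¬P0 ; (suc q′) Pq′ → s≤s (least q′ Pq′) }

module Correspondence {k′ s₀ : ℕ} {S₀ τ : List ℕ}
  (alphabet : OverAlphabet (suc k′) (s₀ ∷ S₀)) (τ-positive : All (1 ≤_) τ) where

  open Heights (List.lookup τ)
  open Columns (List.lookup τ)

  k : ℕ
  k = suc k′
  S : List ℕ
  S = s₀ ∷ S₀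
  m : ℕ
  m = length S
  t : ℕ
  t = length τ

  inFirst : Fin k → Fin (k + (m + t))
  inFirst a = a ↑ˡ (m + t)
  inMiddle : Fin m → Fin (k + (m + t))
  inMiddle b = k ↑ʳ (b ↑ˡ t)
  inLast : Fin t → Fin (k + (m + t))
  inLast c = k ↑ʳ (m ↑ʳ c)

  σ : List ℕ
  σ = ascending k ++ S ++ (τ +ₛ k)

  σf : Fin (k + (m + t)) → ℕ
  σf = glue {k} {m} {t} (suc ∘ toℕ) (List.lookup S) (λ c → List.lookup τ c + k)

  σf-first : ∀ a → σf (inFirst a) ≡ suc (toℕ a)
  σf-first = glue-first {k} {m} {t} (suc ∘ toℕ) (List.lookup S) (λ c → List.lookup τ c + k)

  σf-middle : ∀ b → σf (inMiddle b) ≡ List.lookup S b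
  σf-middle = glue-middle {k} {m} {t} (suc ∘ toℕ) (List.lookup S) (λ c → List.lookup τ c + k)

  σf-last : ∀ c → σf (inLast c) ≡ List.lookup τ c + k
  σf-last = glue-last {k} {m} {t} (suc ∘ toℕ) (List.lookup S) (λ c → List.lookup τ c + k)

  length-σ : length σ ≡ k + (m + t)
  length-σ = trans (Listₚ.length-++ (ascending k))
    (cong₂ _+_ (length-ascending k) (trans (Listₚ.length-++ S) (cong (m +_) (Listₚ.length-map (_+ k) τ))))

  nth-σ-rest : ∀ j → nth σ (k + j) ≡ nth (S ++ (τ +ₛ k)) j
  nth-σ-rest j = subst (λ z → nth σ (z + j) ≡ nth (S ++ (τ +ₛ k)) j) (length-ascending k)
                   (nth-++ʳ (ascending k) (S ++ (τ +ₛ k)) j)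

  σf≡nth : ∀ i → σf i ≡ nth σ (toℕ i)
  σf≡nth i with segment {k} {m} {t} i
  ... | first a = begin
    σf (a ↑ˡ (m + t))          ≡⟨ σf-first a ⟩
    suc (toℕ a)                ≡⟨ nth-ascending k (Finₚ.toℕ<n a) ⟨
    nth (ascending k) (toℕ a)  ≡⟨ nth-++ˡ (ascending k) _ (subst (toℕ a <_) (sym (length-ascending k)) (Finₚ.toℕ<n a)) ⟨
    nth σ (toℕ a)              ≡⟨ cong (nth σ) (Finₚ.toℕ-↑ˡ a (m + t)) ⟨
    nth σ (toℕ (a ↑ˡ (m + t))) ∎
    where open ≡-Reasoning
  ... | middle b = begin
    σf (k ↑ʳ (b ↑ˡ t))                   ≡⟨ σf-middle b ⟩
    List.lookup S b                      ≡⟨ lookup≡nth S b ⟩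
    nth S (toℕ b)                        ≡⟨ nth-++ˡ S _ (Finₚ.toℕ<n b) ⟨
    nth (S ++ (τ +ₛ k)) (toℕ b)          ≡⟨ nth-σ-rest (toℕ b) ⟨
    nth σ (k + toℕ b)                    ≡⟨ cong (λ j → nth σ (k + j)) (Finₚ.toℕ-↑ˡ b t) ⟨
    nth σ (k + toℕ (b ↑ˡ t))             ≡⟨ cong (nth σ) (Finₚ.toℕ-↑ʳ k (b ↑ˡ t)) ⟨
    nth σ (toℕ (k ↑ʳ (b ↑ˡ t)))          ∎
    where open ≡-Reasoning
  ... | last c = begin
    σf (k ↑ʳ (m ↑ʳ c))                   ≡⟨ σf-last c ⟩
    List.lookup τ c + k                  ≡⟨ cong (_+ k) (lookup≡nth τ c) ⟩
    nth τ (toℕ c) + k                    ≡⟨ nth-map (_+ k) τ (Finₚ.toℕ<n c) ⟨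
    nth (τ +ₛ k) (toℕ c)                 ≡⟨ nth-++ʳ S _ (toℕ c) ⟨
    nth (S ++ (τ +ₛ k)) (m + toℕ c)      ≡⟨ nth-σ-rest (m + toℕ c) ⟨
    nth σ (k + (m + toℕ c))              ≡⟨ cong (λ j → nth σ (k + j)) (Finₚ.toℕ-↑ʳ m c) ⟨
    nth σ (k + toℕ (m ↑ʳ c))             ≡⟨ cong (nth σ) (Finₚ.toℕ-↑ʳ k (m ↑ʳ c)) ⟨
    nth σ (toℕ (k ↑ʳ (m ↑ʳ c)))          ∎
    where open ≡-Reasoning

  lookup-σ : ∀ i → List.lookup σ i ≡ σf (Fin.cast length-σ i)
  lookup-σ i = begin
    List.lookup σ i                  ≡⟨ lookup≡nth σ i ⟩
    nth σ (toℕ i)                    ≡⟨ cong (nth σ) (Finₚ.toℕ-cast length-σ i) ⟨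
    nth σ (toℕ (Fin.cast length-σ i)) ≡⟨ σf≡nth (Fin.cast length-σ i) ⟨
    σf (Fin.cast length-σ i)         ∎
    where open ≡-Reasoning

  -- column b of M(S, k) has its 1 in row letter b, i.e. in row s_b counted from 1
  letter : Fin m → Fin k
  letter b = fromℕ< (fits⇒pred< (All.lookup alphabet (∈-lookup b)))

  suc-letter : ∀ b → suc (toℕ (letter b)) ≡ List.lookup S b
  suc-letter b = let inAlphabet = All.lookup alphabet (∈-lookup b) in
    trans (cong suc (Finₚ.toℕ-fromℕ< (fits⇒pred< inAlphabet))) (suc-pred _ {{>-nonZero (proj₁ inAlphabet)}})

  M-letter : ∀ b → M[ S , k ] (letter b) b ≡ true
  M-letter b = Equivalence.to T-≡ (≡⇒≡ᵇ _ _ (sym (suc-letter b)))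

  M≡true⇒letter : ∀ a b → M[ S , k ] a b ≡ true → a ≡ letter b
  M≡true⇒letter a b isOne = Finₚ.toℕ-injective (suc-injective (begin
    suc (toℕ a)         ≡⟨ ≡ᵇ⇒≡ _ _ (Equivalence.from T-≡ isOne) ⟨
    List.lookup S b     ≡⟨ suc-letter b ⟨
    suc (toℕ (letter b)) ∎))
    where open ≡-Reasoning

  -- an occurrence of M(S, k) in the filling of x, read off in x: row a of M is row rows a - 1
  -- of the filling, column b is the column at position positions b
  record Occurrence {N} (x : Fin N → ℕ) : Set where
    field
      rows : Fin k → ℕ
      positions : Fin m → Fin N
      rows-increasing : StrictlyIncreasingFinℕ rows
      rows-positive : ∀ a → 1 ≤ rows a
      positions-increasing : StrictlyIncreasingFin positions
      x-positions : ∀ b → x (positions b) ≡ rows (letter b)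
      rows≤height : ∀ a b → rows a ≤ columnHeight x (positions b)

  contains⇒occurrence : ∀ {N} (x : Fin N → ℕ) → Contains M[ S , k ] (fillingOf x) → Occurrence x
  contains⇒occurrence {N} x (rowsM , cols , rows-inc , cols-inc , inside , isOne) = record
    { rows = suc ∘ rowsM
    ; positions = col ∘ cols
    ; rows-increasing = λ a a′ a<a′ → s≤s (rows-inc a a′ a<a′)
    ; rows-positive = λ _ → s≤s z≤n
    ; positions-increasing = λ b b′ b<b′ →
        column-increasing (active x) (columnHeight x) (cols b) (cols b′) (cols-inc b b′ b<b′)
    ; x-positions = x-positions
    ; rows≤height = λ a b → subst (rowsM a <_) (lookup-shape (active x) (columnHeight x) (cols b)) (inside a b)
    }
    where
    col : Fin (length (shapeOf x)) → Fin N
    col = column (active x) (columnHeight x)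
    x-positions : ∀ b → x (col (cols b)) ≡ suc (rowsM (letter b))
    x-positions b = begin
      x q                    ≡⟨ suc-pred _ {{>-nonZero (proj₁ fits)}} ⟨
      suc (pred (x q))       ≡⟨ cong suc (cell-unitColumn {columnHeight x q} oneInRow) ⟨
      suc (rowsM (letter b)) ∎
      where
      open ≡-Reasoning
      q : Fin N
      q = col (cols b)
      fits : Fits (x q) (columnHeight x q)
      fits = active⇒fits x (column-selected (active x) (columnHeight x) (cols b))
      oneInRow : cell (unitColumn (columnHeight x q) (pred (x q))) (rowsM (letter b)) ≡ true
      oneInRow = trans (sym (entry-encode (active x) (columnHeight x) x (cols b) _)) (isOne (letter b) b (M-letter b))

  occurrence⇒contains : ∀ {N} (x : Fin N → ℕ) → Occurrence x → Contains M[ S , k ] (fillingOf x)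
  occurrence⇒contains {N} x o = pred ∘ rows , cols , rows-inc , cols-inc , inside , isOne
    where
    open Occurrence o
    col : Fin (length (shapeOf x)) → Fin N
    col = column (active x) (columnHeight x)
    fits : ∀ b → Fits (x (positions b)) (columnHeight x (positions b))
    fits b = subst (λ v → Fits v (columnHeight x (positions b))) (sym (x-positions b))
               (rows-positive (letter b) , rows≤height (letter b) b)
    columnOf : ∀ b → ∃ λ c → col c ≡ positions b
    columnOf b = column-surjective (active x) (columnHeight x) (dec-true (fits? _ _) (fits b))
    cols : Fin m → Fin (length (shapeOf x))
    cols = proj₁ ∘ columnOf
    rows-inc : StrictlyIncreasingFinℕ (pred ∘ rows)
    rows-inc a a′ a<a′ = pred-mono-< {{>-nonZero (rows-positive a)}} (rows-increasing a a′ a<a′)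
    cols-inc : StrictlyIncreasingFin cols
    cols-inc = strictlyIncreasing-factor (proj₂ ∘ columnOf) (column-increasing (active x) (columnHeight x)) positions-increasing
    pred-row<height : ∀ a b → pred (rows a) < columnHeight x (positions b)
    pred-row<height a b = fits⇒pred< (rows-positive a , rows≤height a b)
    inside : ∀ a b → pred (rows a) < List.lookup (shapeOf x) (cols b)
    inside a b = subst (pred (rows a) <_)
      (sym (trans (lookup-shape (active x) (columnHeight x) (cols b)) (cong (columnHeight x) (proj₂ (columnOf b)))))
      (pred-row<height a b)
    isOne : ∀ a b → M[ S , k ] a b ≡ true → entry (fillingOf x) (cols b) (pred (rows a)) ≡ true
    isOne a b M≡true with M≡true⇒letter a b M≡true
    ... | refl = trans (entry-encode (active x) (columnHeight x) x (cols b) _)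
      (subst (λ q → cell (unitColumn (columnHeight x q) (pred (x q))) (pred (rows a)) ≡ true) (sym (proj₂ (columnOf b)))
        (subst (λ v → cell (unitColumn (columnHeight x (positions b)) (pred v)) (pred (rows a)) ≡ true) (sym (x-positions b))
          (cell-unitColumn-self (pred-row<height a b))))

  first<middle : ∀ a b → inFirst a Fin.< inMiddle b
  first<middle a b = ↑ˡ<↑ʳ a (b ↑ˡ t)
  first<last : ∀ a c → inFirst a Fin.< inLast c
  first<last a c = ↑ˡ<↑ʳ a (m ↑ʳ c)
  middle<last : ∀ b c → inMiddle b Fin.< inLast c
  middle<last b c = Equivalence.from (↑ʳ-<⇔ k) (↑ˡ<↑ʳ b c)
  first-<⇔ : ∀ {a a′} → (inFirst a Fin.< inFirst a′) ⇔ (a Fin.< a′)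
  first-<⇔ = ↑ˡ-<⇔ (m + t)
  middle-<⇔ : ∀ {b b′} → (inMiddle b Fin.< inMiddle b′) ⇔ (b Fin.< b′)
  middle-<⇔ = mk⇔ (Equivalence.to (↑ˡ-<⇔ t) ∘ Equivalence.to (↑ʳ-<⇔ k))
                  (Equivalence.from (↑ʳ-<⇔ k) ∘ Equivalence.from (↑ˡ-<⇔ t))
  last-<⇔ : ∀ {c c′} → (inLast c Fin.< inLast c′) ⇔ (c Fin.< c′)
  last-<⇔ = mk⇔ (Equivalence.to (↑ʳ-<⇔ m) ∘ Equivalence.to (↑ʳ-<⇔ k))
                (Equivalence.from (↑ʳ-<⇔ k) ∘ Equivalence.from (↑ʳ-<⇔ m))

  ascending<τ+k : ∀ (a : Fin k) c → suc (toℕ a) < List.lookup τ c + k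
  ascending<τ+k a c = <-≤-trans (s≤s (Finₚ.toℕ<n a)) (+-monoˡ-≤ k (All.lookup τ-positive (∈-lookup c)))

  embedding⇒occurrence : ∀ {N} (x : Fin N → ℕ) → RestrictedGrowthFun x → Embeds σf x → Occurrence x
  embedding⇒occurrence x rg (ι , inc , iso) = record
    { rows = rows
    ; positions = ι ∘ inMiddle
    ; rows-increasing = λ a a′ a<a′ → preserves (σf-first a) (σf-first a′) (s≤s a<a′)
    ; rows-positive = λ a → proj₁ (rg _)
    ; positions-increasing = λ b b′ b<b′ → inc _ _ (Equivalence.from middle-<⇔ b<b′)
    ; x-positions = λ b → orderIsomorphic-≡ {g = x} {ι} iso
        (trans (σf-middle b) (trans (sym (suc-letter b)) (sym (σf-first (letter b)))))
    ; rows≤height = λ a b → tauAbove⇒≤-height x _ (≤-prefixMax x _ (inc _ _ (first<middle a b))) (tauAbove-rows a b)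
    }
    where
    rows : Fin k → ℕ
    rows a = x (ι (inFirst a))
    preserves : ∀ {i j u v} → σf i ≡ u → σf j ≡ v → u < v → x (ι i) < x (ι j)
    preserves {i} {j} refl refl = proj₁ (iso i j)
    reflects : ∀ {i j u v} → σf i ≡ u → σf j ≡ v → x (ι i) < x (ι j) → u < v
    reflects {i} {j} refl refl = proj₂ (iso i j)
    tauAbove-rows : ∀ a b → TauAbove x (toℕ (ι (inMiddle b))) (rows a)
    tauAbove-rows a b = tauAbove (ι ∘ inLast) (λ c c′ c<c′ → inc _ _ (Equivalence.from last-<⇔ c<c′))
      (λ c → inc _ _ (middle<last b c)) (λ c → preserves (σf-first a) (σf-last c) (ascending<τ+k a c))
      λ c c′ → (λ τc<τc′ → preserves (σf-last c) (σf-last c′) (+-monoˡ-< k τc<τc′)) ,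
               (λ x< → +-cancelʳ-< k _ _ (reflects (σf-last c) (σf-last c′) x<))

  -- values 1 .. k are placed at their first occurrences, S at the positions of the occurrence,
  -- and τ + k at an occurrence of τ above all rows and right of all positions
  occurrence⇒embedding : ∀ {N} (x : Fin N → ℕ) → RestrictedGrowthFun x → Occurrence x → Embeds σf x
  occurrence⇒embedding {N} x rg o = ι , increasing , λ i j → sameOrder i j
    where
    open Occurrence o

    topRow : Fin k
    topRow = Fin.fromℕ k′
    firstLetter lastLetter : Fin m
    firstLetter = zero
    lastLetter = Fin.fromℕ (length S₀)

    firstOccurrence : ∀ a → ∃ λ q → x q ≡ rows a × (∀ q′ → x q′ ≡ rows a → toℕ q ≤ toℕ q′)
    firstOccurrence a = firstSatisfying (λ q → x q ≟ rows a)
      (let (q , _ , xq≡) = prefixMax-attained x rg (toℕ (positions firstLetter)) (rows-positive a)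
                             (≤-trans (rows≤height a firstLetter) (height≤prefixMax x _)) in q , xq≡)

    leftmost : Fin k → Fin N
    leftmost = proj₁ ∘ firstOccurrence
    x-leftmost : ∀ a → x (leftmost a) ≡ rows a
    x-leftmost = proj₁ ∘ proj₂ ∘ firstOccurrence

    leftmost-before : ∀ a {p} → rows a ≤ prefixMax x p → toℕ (leftmost a) < p
    leftmost-before a {p} a≤max = let (q , q<p , xq≡) = prefixMax-attained x rg p (rows-positive a) a≤max in
      ≤-<-trans (proj₂ (proj₂ (firstOccurrence a)) q xq≡) q<p

    leftmost-increasing : StrictlyIncreasingFin leftmost
    leftmost-increasing a a′ a<a′ = leftmost-before a (≤-pred (begin-strict
      rows a                                      <⟨ rows-increasing a a′ a<a′ ⟩
      rows a′                                     ≡⟨ x-leftmost a′ ⟨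
      x (leftmost a′)                             ≤⟨ proj₂ (rg (leftmost a′)) ⟩
      suc (prefixMax x (toℕ (leftmost a′)))       ∎))
      where open ≤-Reasoning

    leftmost<positions : ∀ a b → leftmost a Fin.< positions b
    leftmost<positions a b = <-≤-trans
      (leftmost-before a (≤-trans (rows≤height a firstLetter) (height≤prefixMax x _)))
      (strictlyIncreasing-mono {f = toℕ ∘ positions} positions-increasing firstLetter b z≤n)

    tau : TauAbove x (toℕ (positions lastLetter)) (rows topRow)
    tau = ≤-height⇒tauAbove x _ (rows-positive topRow) (rows≤height topRow lastLetter)
    open TauAbove tau using (rightOf; above; isomorphic) renaming (positions to tauPositions; increasing to tauPositions-increasing)

    positions<tau : ∀ b c → positions b Fin.< tauPositions c
    positions<tau b c = ≤-<-trans
      (strictlyIncreasing-mono {f = toℕ ∘ positions} positions-increasing b lastLetter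
        (subst (toℕ b ≤_) (sym (Finₚ.toℕ-fromℕ _)) (Finₚ.toℕ≤pred[n] b)))
      (rightOf c)

    rows<tau : ∀ a c → rows a < x (tauPositions c)
    rows<tau a c = ≤-<-trans
      (strictlyIncreasing-mono rows-increasing a topRow (subst (toℕ a ≤_) (sym (Finₚ.toℕ-fromℕ k′)) (Finₚ.toℕ≤pred[n] a)))
      (above c)

    ι : Fin (k + (m + t)) → Fin N
    ι = glue leftmost positions tauPositions

    ι-first : ∀ a → ι (inFirst a) ≡ leftmost a
    ι-first = glue-first leftmost positions tauPositions
    ι-middle : ∀ b → ι (inMiddle b) ≡ positions b
    ι-middle = glue-middle leftmost positions tauPositions
    ι-last : ∀ c → ι (inLast c) ≡ tauPositions c
    ι-last = glue-last {k} {m} leftmost positions tauPositions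

    increasing : StrictlyIncreasingFin ι
    increasing i j i<j with segment {k} {m} {t} i | segment {k} {m} {t} j
    ... | first a | first a′ rewrite ι-first a | ι-first a′ = leftmost-increasing a a′ (Equivalence.to first-<⇔ i<j)
    ... | first a | middle b rewrite ι-first a | ι-middle b = leftmost<positions a b
    ... | first a | last c rewrite ι-first a | ι-last c = <-trans (leftmost<positions a firstLetter) (positions<tau firstLetter c)
    ... | middle b | first a = contradiction i<j (<-asym (first<middle a b))
    ... | middle b | middle b′ rewrite ι-middle b | ι-middle b′ = positions-increasing b b′ (Equivalence.to middle-<⇔ i<j)
    ... | middle b | last c rewrite ι-middle b | ι-last c = positions<tau b c
    ... | last c | first a = contradiction i<j (<-asym (first<last a c))
    ... | last c | middle b = contradiction i<j (<-asym (middle<last b c))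
    ... | last c | last c′ rewrite ι-last c | ι-last c′ = tauPositions-increasing c c′ (Equivalence.to last-<⇔ i<j)

    classify : ∀ i → (∃ λ a → σf i ≡ suc (toℕ a) × x (ι i) ≡ rows a) ⊎
                     (∃ λ c → σf i ≡ List.lookup τ c + k × x (ι i) ≡ x (tauPositions c))
    classify i with segment {k} {m} {t} i
    ... | first a = inj₁ (a , σf-first a , trans (cong x (ι-first a)) (x-leftmost a))
    ... | middle b = inj₁ (letter b , trans (σf-middle b) (sym (suc-letter b)) , trans (cong x (ι-middle b)) (x-positions b))
    ... | last c = inj₂ (c , σf-last c , cong x (ι-last c))

    sameOrder : ∀ i j → SameOrder (σf i) (σf j) (x (ι i)) (x (ι j))
    sameOrder i j with classify i | classify j
    ... | inj₁ (a , σi , xi) | inj₁ (a′ , σj , xj) = sameOrder-resp σi σj xi xj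
      ((λ a<a′ → rows-increasing a a′ (≤-pred a<a′)) , λ ra<ra′ → s≤s (strictlyIncreasing-reflects rows-increasing ra<ra′))
    ... | inj₁ (a , σi , xi) | inj₂ (c , σj , xj) = sameOrder-resp σi σj xi xj
      ((λ _ → rows<tau a c) , λ _ → ascending<τ+k a c)
    ... | inj₂ (c , σi , xi) | inj₁ (a , σj , xj) = sameOrder-resp σi σj xi xj
      ((λ τ<a → contradiction τ<a (<-asym (ascending<τ+k a c))) , λ τ<a → contradiction τ<a (<-asym (rows<tau a c)))
    ... | inj₂ (c , σi , xi) | inj₂ (c′ , σj , xj) = sameOrder-resp σi σj xi xj
      ((λ τ<τ → proj₁ (isomorphic c c′) (+-cancelʳ-< k _ _ τ<τ)) , λ x<x → +-monoˡ-< k (proj₂ (isomorphic c c′) x<x))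

  embeds⇔contains : ∀ {N} (x : Fin N → ℕ) → RestrictedGrowthFun x →
    Embeds (List.lookup σ) x ⇔ Contains M[ S , k ] (fillingOf x)
  embeds⇔contains x rg = mk⇔
    (occurrence⇒contains x ∘ embedding⇒occurrence x rg ∘ Equivalence.to σ≈σf)
    (Equivalence.from σ≈σf ∘ occurrence⇒embedding x rg ∘ contains⇒occurrence x)
    where
    σ≈σf : Embeds (List.lookup σ) x ⇔ Embeds σf x
    σ≈σf = embeds-reindexˡ {g = x} length-σ lookup-σ

RestrictedGrowthFrom : ∀ {N} → ℕ → (Fin N → ℕ) → Set
RestrictedGrowthFrom m x = ∀ q → 1 ≤ x q × x q ≤ suc (m ⊔ prefixMax x (toℕ q))

restrictedGrowth⇔ : ∀ {n} m (v : Vec ℕ n) → RestrictedGrowth m (toList v) ⇔ RestrictedGrowthFrom m (Vec.lookup v)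
restrictedGrowth⇔ m [] = mk⇔ (λ _ ()) (λ _ → tt)
restrictedGrowth⇔ m (a ∷ v) = mk⇔ to from
  where
  shift : ∀ q → m ⊔ a ⊔ prefixMax (Vec.lookup v) (toℕ q) ≡ m ⊔ prefixMax (Vec.lookup (a ∷ v)) (suc (toℕ q))
  shift q = trans (⊔-assoc m a _) (cong (m ⊔_) (sym (prefixMax-suc (Vec.lookup (a ∷ v)) (toℕ q))))
  to : RestrictedGrowth m (a ∷ toList v) → RestrictedGrowthFrom m (Vec.lookup (a ∷ v))
  to (1≤a , a≤ , rest) zero = 1≤a , subst (λ z → a ≤ suc z) (sym (⊔-identityʳ m)) a≤
  to (1≤a , a≤ , rest) (suc q) = let (1≤vq , vq≤) = Equivalence.to (restrictedGrowth⇔ (m ⊔ a) v) rest q in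
    1≤vq , subst (λ z → Vec.lookup v q ≤ suc z) (shift q) vq≤
  from : RestrictedGrowthFrom m (Vec.lookup (a ∷ v)) → RestrictedGrowth m (a ∷ toList v)
  from rg = proj₁ (rg zero) , subst (λ z → a ≤ suc z) (⊔-identityʳ m) (proj₂ (rg zero)) ,
    Equivalence.from (restrictedGrowth⇔ (m ⊔ a) v)
      λ q → proj₁ (rg (suc q)) , subst (λ z → Vec.lookup v q ≤ suc z) (sym (shift q)) (proj₂ (rg (suc q)))

isPartition⇔ : ∀ {n} (v : Vec ℕ n) → IsPartition (toList v) ⇔ RestrictedGrowthFun (Vec.lookup v)
isPartition⇔ = restrictedGrowth⇔ 0

lookup-toList : ∀ {n} (v : Vec ℕ n) j → List.lookup (toList v) j ≡ Vec.lookup v (Fin.cast (Vecₚ.length-toList v) j)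
lookup-toList (a ∷ v) zero = refl
lookup-toList (a ∷ v) (suc j) = lookup-toList v j

containsPattern⇔ : ∀ {n} (σ : List ℕ) (v : Vec ℕ n) → ContainsPattern σ (toList v) ⇔ Embeds (List.lookup σ) (Vec.lookup v)
containsPattern⇔ σ v = embeds-reindexʳ {f = List.lookup σ} {g′ = Vec.lookup v} (Vecₚ.length-toList v) (lookup-toList v)

stackPolyomino? : ∀ hs → Dec (IsStackPolyomino hs)
stackPolyomino? hs = All.all? (1 ≤?_) hs ×-dec
  (Finₚ.all? λ j₁ → Finₚ.all? λ j₂ → Finₚ.all? λ j₃ → j₁ Finₚ.<? j₂ →-dec j₂ Finₚ.<? j₃ →-dec
    (List.lookup hs j₁ ⊓ List.lookup hs j₃) ≤? List.lookup hs j₂)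

semiStandard? : ∀ {hs} (F : Filling hs) → Dec (SemiStandard F)
semiStandard? [] = yes tt
semiStandard? (v ∷ F) = (ones v ≟ 1) ×-dec semiStandard? F

recomputeIrrelevant : ∀ {A : Set} → Dec A → Irrelevant A → A
recomputeIrrelevant a? [ a ] = recompute a? a

⊥-irrelevant : ∀ {A : Set} → Irrelevant ⊥ → A
⊥-irrelevant [ () ]

-- a proof depending on the shape only, so that G hs p does not depend on the choice of p
opaque
  canonicalStack : ∀ hs → .(IsStackPolyomino hs) → IsStackPolyomino hs
  canonicalStack hs p = recompute (stackPolyomino? hs) p

contains-subst : ∀ {r c} (M : Matrix r c) {hs hs′} (hs≡hs′ : hs ≡ hs′) (F : Filling hs) →
  Contains M F → Contains M (subst Filling hs≡hs′ F)
contains-subst M refl F contains = contains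

Σ-irrelevant-≡ : ∀ {A : Set} {B : A → Set} {a a′ : A} {b : Irrelevant (B a)} {b′ : Irrelevant (B a′)} →
  a ≡ a′ → _≡_ {A = Σ A (Irrelevant ∘ B)} (a , b) (a′ , b′)
Σ-irrelevant-≡ refl = refl

PatternCorrespondence : ∀ {t r c} → (Fin t → ℕ) → List ℕ → Matrix r c → Set
PatternCorrespondence τ σ M =
  ∀ {N} (x : Fin N → ℕ) → RestrictedGrowthFun x → Embeds (List.lookup σ) x ⇔ Contains M (Columns.fillingOf τ x)

GoodPartition : ∀ {n} → List ℕ → Vec ℕ n → Set
GoodPartition σ v = IsPartition (toList v) × AvoidsPattern σ (toList v)

module Transfer {t : ℕ} (τ : Fin t → ℕ) {r c r′ c′} {M : Matrix r c} {M′ : Matrix r′ c′} {σ σ′ : List ℕ}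
  (σ⇔M : PatternCorrespondence τ σ M) (σ′⇔M′ : PatternCorrespondence τ σ′ M′)
  (G : ∀ hs → IsStackPolyomino hs → AvoidingFillings M hs → AvoidingFillings M′ hs)
  (n : ℕ) where

  open Columns τ

  G̃ : ∀ hs → .(IsStackPolyomino hs) → AvoidingFillings M hs → AvoidingFillings M′ hs
  G̃ hs p = G hs (canonicalStack hs p)

  avoidingFilling : (v : Vec ℕ n) → .(GoodPartition σ v) → AvoidingFillings M (shapeOf (Vec.lookup v))
  avoidingFilling v good = fillingOf x ,
    [ fillingOf-semiStandard x , proj₂ good ∘ Equivalence.from (containsPattern⇔ σ v)
                                            ∘ Equivalence.from (σ⇔M x (Equivalence.to (isPartition⇔ v) (proj₁ good))) ]
    where
    x : Fin n → ℕ
    x = Vec.lookup v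

  image : (v : Vec ℕ n) → .(GoodPartition σ v) → AvoidingFillings M′ (shapeOf (Vec.lookup v))
  image v good = G̃ (shapeOf (Vec.lookup v)) (shapeOf-stack (Vec.lookup v)) (avoidingFilling v good)

  image-semiStandard : (v : Vec ℕ n) → .(good : GoodPartition σ v) → SemiStandard (proj₁ (image v good))
  image-semiStandard v good = recomputeIrrelevant (semiStandard? _) (Irrelevant.map proj₁ (proj₂ (image v good)))

  transferred : (v : Vec ℕ n) → .(GoodPartition σ v) → Fin n → ℕ
  transferred v good = decode (active (Vec.lookup v)) (columnHeight (Vec.lookup v)) (Vec.lookup v) (proj₁ (image v good))

  transferred-good : (v : Vec ℕ n) (good : GoodPartition σ v) → GoodPartition σ′ (tabulate (transferred v good))
  transferred-good v good = Equivalence.from (isPartition⇔ v′) (restrictedGrowth-cong y≗v′ rg-y) , avoids′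
    where
    x : Fin n → ℕ
    x = Vec.lookup v
    F′ : Filling (shapeOf x)
    F′ = proj₁ (image v good)
    open Decoding x F′ (image-semiStandard v good)
    v′ : Vec ℕ n
    v′ = tabulate y
    y≗v′ : y ≗ Vec.lookup v′
    y≗v′ q = sym (Vecₚ.lookup∘tabulate y q)
    rg-y : RestrictedGrowthFun y
    rg-y = restrictedGrowth-y (Equivalence.to (isPartition⇔ v) (proj₁ good))
    fillingOf-y≡F′ : subst Filling shapeOf-y (fillingOf y) ≡ F′
    fillingOf-y≡F′ = toLists-injective _ F′ (trans (toLists-subst shapeOf-y (fillingOf y)) fillingOf-y)
    contains′ : ContainsPattern σ′ (toList v′) → Contains M′ F′
    contains′ = subst (Contains M′) fillingOf-y≡F′
              ∘ contains-subst M′ shapeOf-y (fillingOf y)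
              ∘ Equivalence.to (σ′⇔M′ y rg-y)
              ∘ embeds-congʳ (sym ∘ y≗v′)
              ∘ Equivalence.to (containsPattern⇔ σ′ v′)
    avoids′ : AvoidsPattern σ′ (toList v′)
    avoids′ contains = ⊥-irrelevant (Irrelevant.map (λ (_ , avoids) → avoids (contains′ contains)) (proj₂ (image v good)))

  transfer : AvoidingPartitions σ n → AvoidingPartitions σ′ n
  transfer (v , [ good ]) = tabulate (transferred v good) , [ transferred-good v good ]

module RoundTrip {t : ℕ} (τ : Fin t → ℕ) {r c r′ c′} {M : Matrix r c} {M′ : Matrix r′ c′} {σ σ′ : List ℕ}
  (σ⇔M : PatternCorrespondence τ σ M) (σ′⇔M′ : PatternCorrespondence τ σ′ M′)
  (G : ∀ hs → IsStackPolyomino hs → AvoidingFillings M hs → AvoidingFillings M′ hs)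
  (G⁻¹ : ∀ hs → IsStackPolyomino hs → AvoidingFillings M′ hs → AvoidingFillings M hs)
  (inverse : ∀ hs p X → proj₁ (G⁻¹ hs p (G hs p X)) ≡ proj₁ X)
  (n : ℕ) where

  open Columns τ
  module There = Transfer τ {σ = σ} {σ′} σ⇔M σ′⇔M′ G n
  module Back = Transfer τ {σ = σ′} {σ} σ′⇔M′ σ⇔M G⁻¹ n

  Back-G̃-subst : ∀ {hs hs′} (hs≡hs′ : hs ≡ hs′) .(p : IsStackPolyomino hs) .(p′ : IsStackPolyomino hs′)
    (X : AvoidingFillings M′ hs) (Y : AvoidingFillings M′ hs′) → proj₁ Y ≡ subst Filling hs≡hs′ (proj₁ X) →
    proj₁ (Back.G̃ hs′ p′ Y) ≡ subst Filling hs≡hs′ (proj₁ (Back.G̃ hs p X))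
  Back-G̃-subst refl p p′ (F , _) (.F , _) refl = refl

  transfer-inverse : ∀ w → Back.transfer (There.transfer w) ≡ w
  transfer-inverse (v , [ good ]) = Σ-irrelevant-≡ (begin
    tabulate (Back.transferred v′ (There.transferred-good v good)) ≡⟨ Vecₚ.tabulate-cong decoded≗x ⟩
    tabulate x                                                     ≡⟨ Vecₚ.tabulate∘lookup v ⟩
    v                                                              ∎)
    where
    open ≡-Reasoning
    x : Fin n → ℕ
    x = Vec.lookup v
    X : AvoidingFillings M′ (shapeOf x)
    X = There.image v good
    open Decoding x (proj₁ X) (There.image-semiStandard v good)
    v′ : Vec ℕ n
    v′ = tabulate y
    x′ : Fin n → ℕ
    x′ = Vec.lookup v′
    x′≗y : x′ ≗ y
    x′≗y = Vecₚ.lookup∘tabulate y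
    columnHeight-x′ : columnHeight x′ ≗ columnHeight x
    columnHeight-x′ q = trans (columnHeight-resp x′≗y q) (columnHeight-y q)
    active-x′ : active x′ ≗ active x
    active-x′ q = trans (active-resp x′≗y q) (active-y q)
    shape≡ : shapeOf x ≡ shapeOf x′
    shape≡ = sym (shape-cong active-x′ columnHeight-x′)
    fillingOf-x′ : fillingOf x′ ≡ subst Filling shape≡ (proj₁ X)
    fillingOf-x′ = toLists-injective _ _ (begin
      toLists (fillingOf x′)                         ≡⟨ encode-cong active-x′ columnHeight-x′ x′≗y ⟩
      toLists (encode (active x) (columnHeight x) y) ≡⟨ fillingOf-y′ ⟩
      toLists (proj₁ X)                              ≡⟨ toLists-subst shape≡ (proj₁ X) ⟨
      toLists (subst Filling shape≡ (proj₁ X))       ∎)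
      where
      fillingOf-y′ : toLists (encode (active x) (columnHeight x) y) ≡ toLists (proj₁ X)
      fillingOf-y′ = encode-decode (active x) x (proj₁ X) (λ _ → refl) (There.image-semiStandard v good)
    backImage : Filling (shapeOf x′)
    backImage = proj₁ (Back.image v′ (There.transferred-good v good))
    backImage≡ : toLists backImage ≡ toLists (fillingOf x)
    backImage≡ = begin
      toLists backImage                                    ≡⟨ cong toLists (Back-G̃-subst shape≡ (shapeOf-stack x) (shapeOf-stack x′)
                                                                X (Back.avoidingFilling v′ (There.transferred-good v good)) fillingOf-x′) ⟩
      toLists (subst Filling shape≡ (proj₁ (Back.G̃ _ _ X))) ≡⟨ toLists-subst shape≡ _ ⟩
      toLists (proj₁ (Back.G̃ (shapeOf x) (shapeOf-stack x) X))
        ≡⟨ cong toLists (inverse (shapeOf x) _ (There.avoidingFilling v good)) ⟩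
      toLists (fillingOf x)                                ∎
    decoded≗x : Back.transferred v′ (There.transferred-good v good) ≗ x
    decoded≗x q = trans (decode-cong backImage (fillingOf x) active-x′ agree backImage≡ q)
                        (decode-encode (active x) (columnHeight x) x (λ q → active⇒fits x) q)
      where
      agree : ∀ q → active x′ q ≡ false → x′ q ≡ x q
      agree q inactive = trans (x′≗y q) (y-inactive q (trans (sym (active-x′ q)) inactive))

restrictedGrowth-positive : ∀ m l → RestrictedGrowth m l → All (1 ≤_) l
restrictedGrowth-positive m [] _ = []
restrictedGrowth-positive m (a ∷ l) (1≤a , _ , rest) = 1≤a ∷ restrictedGrowth-positive (m ⊔ a) l rest

emptyShape-stack : IsStackPolyomino []
emptyShape-stack = [] , λ ()

-- on the empty shape, the empty filling avoids every matrix with a column but none without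
¬emptyMatrix↔nonemptyMatrix : ∀ {k s S} → AvoidingFillings M[ [] , k ] [] ↔ AvoidingFillings M[ s ∷ S , k ] [] → ⊥
¬emptyMatrix↔nonemptyMatrix e =
  ⊥-irrelevant (Irrelevant.map (λ (_ , avoids) → avoids (containsEmpty _)) (proj₂ (Inverse.from e emptyAvoiding)))
  where
  containsEmpty : (F : Filling []) → Contains M[ [] , _ ] F
  containsEmpty F = toℕ , (λ ()) , (λ _ _ a<b → a<b) , (λ ()) , (λ _ ()) , (λ _ ())
  emptyAvoiding : AvoidingFillings M[ _ ∷ _ , _ ] []
  emptyAvoiding = [] , [ tt , (λ (_ , cols , _) → Finₚ.¬Fin0 (cols zero)) ]

mainTheorem16 : (k : ℕ) (τ S S' : List ℕ) → IsPartition τ →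
    OverAlphabet k S → OverAlphabet k S' →
    StackEquivalent M[ S , k ] M[ S' , k ] →
    PatternEquivalent (ascending k ++ S ++ (τ +ₛ k)) (ascending k ++ S' ++ (τ +ₛ k))
mainTheorem16 k τ [] [] _ _ _ _ n = ↔-refl
mainTheorem16 k τ [] (_ ∷ _) _ _ _ E n = ⊥-elim (¬emptyMatrix↔nonemptyMatrix (E [] emptyShape-stack))
mainTheorem16 k τ (_ ∷ _) [] _ _ _ E n = ⊥-elim (¬emptyMatrix↔nonemptyMatrix (↔-sym (E [] emptyShape-stack)))
mainTheorem16 zero τ (_ ∷ _) (_ ∷ _) _ ((1≤s , s≤0) ∷ _) _ _ n = contradiction (≤-trans 1≤s s≤0) λ ()
mainTheorem16 (suc k′) τ (_ ∷ _) (_ ∷ _) τ-partition α α′ E n =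
  mk↔ₛ′ There.transfer Back.transfer Back-There.transfer-inverse There-Back.transfer-inverse
  where
  τ-positive : All (1 ≤_) τ
  τ-positive = restrictedGrowth-positive 0 τ τ-partition
  module C = Correspondence α τ-positive
  module C′ = Correspondence α′ τ-positive
  module There-Back = RoundTrip (List.lookup τ) C.embeds⇔contains C′.embeds⇔contains
    (λ hs p → Inverse.to (E hs p)) (λ hs p → Inverse.from (E hs p))
    (λ hs p X → cong proj₁ (Inverse.strictlyInverseʳ (E hs p) X)) n
  module Back-There = RoundTrip (List.lookup τ) C′.embeds⇔contains C.embeds⇔contains
    (λ hs p → Inverse.from (E hs p)) (λ hs p → Inverse.to (E hs p))
    (λ hs p X → cong proj₁ (Inverse.strictlyInverseˡ (E hs p) X)) n
  open There-Back using (module There; module Back)
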